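{- Let $n\geq3$ and $2\leq k\leq n-1$. Then \[ (a^{(n)}_{\underline{i}})_{\underline{i}\in T^{k-1}_{n+1}}=\Omega\circ\Psi\left((a^{(n-1)}_{\underline{i}})_{\underline{i}\in T^{k-1}_{n}}\right). \]
   Context: $\mathbb N$ denotes the positive integers. For $d\geq1$, $N\geq d+1$, $T^d_N=\{(i_1,\ldots,i_{d+1})\in\mathbb N^{d+1}: i_1+\cdots+i_{d+1}=N\}$. A total cyclic order $\pi$ on $[m]=\{0,\ldots,m\}$ is a set of triples corresponding to a placement of the elements on a circle, with $(x,y,z)\in\pi$ iff $x,y,z$ are distinct and $y$ lies on the clockwise arc from $x$ to $z$; a tuple $(x_1,\ldots,x_r)$, $r\geq3$, of distinct elements is a $\pi$-chain if $(x_1,x_i,x_{i+1})\in\pi$ for $2\leq i\leq r-1$ (pairs are always chains). For $1\leq k\leq m$, $\hat{A}_{k,m}$ is the set of total cyclic orders $\pi$ on $[m]$ such that $(i,i+1,\ldots,i+k)$ is a $\pi$-chain for every $0\leq i\leq m-k$. For $i\neq j$ in $[m]$, $L_\pi(i,j)=1+\#\{h\in[m]:(i,h,j)\in\pi\}$. For $2\leq k\leq m$ and $\underline{i}=(i_1,\ldots,i_k)\in T^{k-1}_{m+1}$, let $\check{A}^{(m)}_{\underline{i}}$ be the set of $\pi\in\hat{A}_{k,m}$ with $L_\pi(m+j-k,m+1+j-k)=i_j$ for $1\leq j\leq k-1$ and $L_\pi(m,m+1-k)=i_k$, and $a^{(m)}_{\underline{i}}=\#\check{A}^{(m)}_{\underline{i}}$.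 For $\underline{i}=(i_1,\ldots,i_{d+1})\in T^d_{N+1}$, $\tau(\underline{i})$ is the set of $\underline{i'}=(i'_1,\ldots,i'_{d+1})\in T^d_N$ with $1\leq i'_1\leq i_1-1$, $i'_{d+1}=i_{d+1}+i_1-i'_1-1$, and $i'_j=i_j$ for $2\leq j\leq d$. The operator $\Psi$ sends an array $(b_{\underline{i}})_{\underline{i}\in T^d_N}$ to $(c_{\underline{i}})_{\underline{i}\in T^d_{N+1}}$ with $c_{\underline{i}}=\sum_{\underline{i'}\in\tau(\underline{i})}b_{\underline{i'}}$. The operator $\Omega$ sends $(b_{\underline{i}})_{\underline{i}\in T^d_N}$ to $(c_{\underline{i}})_{\underline{i}\in T^d_N}$ with $c_{(i_1,\ldots,i_{d+1})}=b_{(i_{d+1},i_1,\ldots,i_d)}$. Here $d=k-1$. -}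

module Defs where

open import Data.Nat using (ℕ; zero; suc; _+_; _∸_; _≤_; _%_; _≡ᵇ_; _<ᵇ_)
open import Data.Bool using (Bool; true; false; _∧_; not; if_then_else_)
open import Data.Fin using (Fin; toℕ)
open import Data.List as L using (List; []; _∷_; length; upTo; allFin; concatMap)
open import Data.Vec as V using (Vec; []; _∷_)
open import Data.Vec.Relation.Unary.All using (All)
open import Data.Product using (_×_)
open import Data.Nat.ListAction using () renaming (sum to sumL)
open import Relation.Binary.PropositionalEquality using (_≡_)

allB : List ℕ → (ℕ → Bool) → Bool
allB []       p = true
allB (x ∷ xs) p = p x ∧ allB xs p

countB : List ℕ → (ℕ → Bool) → ℕ
countB []       p = 0
countB (x ∷ xs) p = (if p x then 1 else 0) + countB xs p

range : ℕ → ℕ → List ℕ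
range a b = L.map (a +_) (upTo (suc b ∸ a))

-- total lookup (default value outside the range; never used there below)
at : ∀ {n} → Vec ℕ n → ℕ → ℕ
at []       _       = 0
at (x ∷ xs) zero    = x
at (x ∷ xs) (suc i) = at xs i

-- A placement of the m+1 elements on a circle is recorded by the
-- clockwise position  pos x ∈ {0,...,m}  of each element x (positions are
-- the m+1 equally spaced slots, read clockwise).  Two placements give the
-- same cyclic order iff they differ by a rotation, so every total cyclic
-- order has exactly one placement with element 0 in slot 0.  We therefore
-- represent a total cyclic order on [m] by such a normalised placement.

Placement : ℕ → Set
Placement m = Vec (Fin (suc m)) (suc m)

posOf : ∀ {m} → Placement m → ℕ → ℕ
posOf π x = at (V.map toℕ π) x

isCyclicOrder : ∀ m → Placement m → Bool
isCyclicOrder m π =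
  (posOf π 0 ≡ᵇ 0) ∧
  allB (range 0 m) (λ x → allB (range 0 m) (λ y →
     (x ≡ᵇ y) ∨' not (posOf π x ≡ᵇ posOf π y)))
  where
  _∨'_ : Bool → Bool → Bool
  true  ∨' _ = true
  false ∨' b = b

allVecs : (M n : ℕ) → List (Vec (Fin M) n)
allVecs M zero    = [] ∷ []
allVecs M (suc n) = concatMap (λ f → L.map (f ∷_) (allVecs M n)) (allFin M)

cyclicOrders : (m : ℕ) → List (Placement m)
cyclicOrders m = L.filterᵇ (isCyclicOrder m) (allVecs (suc m) (suc m))

cwDist : ℕ → ℕ → ℕ → ℕ
cwDist m a b = (b + suc m ∸ a) % suc m

distinct3 : ℕ → ℕ → ℕ → Bool
distinct3 x y z = not (x ≡ᵇ y) ∧ not (y ≡ᵇ z) ∧ not (x ≡ᵇ z)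

-- (x,y,z) ∈ π : x,y,z distinct and y lies on the clockwise arc from x to z
inπ : ∀ {m} → Placement m → ℕ → ℕ → ℕ → Bool
inπ {m} π x y z =
  distinct3 x y z ∧
  (cwDist m (posOf π x) (posOf π y) <ᵇ cwDist m (posOf π x) (posOf π z))

Lπ : ∀ {m} → Placement m → ℕ → ℕ → ℕ
Lπ {m} π i j = suc (countB (range 0 m) (λ h → inπ π i h j))

isConsecChain : ∀ {m} → Placement m → ℕ → ℕ → Bool
isConsecChain π k i = allB (range 1 (k ∸ 1)) (λ a → inπ π i (i + a) (i + a + 1))

inAhat : ∀ {m} → ℕ → Placement m → Bool
inAhat {m} k π = allB (range 0 (m ∸ k)) (λ i → isConsecChain π k i)

inAcheck : ∀ {k} (m : ℕ) → Vec ℕ k → Placement m → Bool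
inAcheck {k} m iv π =
  inAhat k π ∧
  allB (range 1 (k ∸ 1))
       (λ j → Lπ π (m + j ∸ k) (m + 1 + j ∸ k) ≡ᵇ at iv (j ∸ 1)) ∧
  (Lπ π m (m + 1 ∸ k) ≡ᵇ at iv (k ∸ 1))

a : ∀ {k} → ℕ → Vec ℕ k → ℕ
a m iv = length (L.filterᵇ (inAcheck m iv) (cyclicOrders m))

-- Index sets and the operators Ψ, Ω on arrays (b_i)_{i ∈ T^d_N},
-- arrays being represented as functions on Vec ℕ (d+1) (only their values
-- on T^d_N matter).

-- i ∈ T^d_N  (with k = d+1 entries)
InT : ∀ {k} → ℕ → Vec ℕ k → Set
InT N iv = All (1 ≤_) iv × V.sum iv ≡ N

addLast : ∀ {n} → ℕ → Vec ℕ n → Vec ℕ n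
addLast c []           = []
addLast c (x ∷ [])     = (x + c) ∷ []
addLast c (x ∷ y ∷ ys) = x ∷ addLast c (y ∷ ys)

Ψ : ∀ {k} → (Vec ℕ k → ℕ) → (Vec ℕ k → ℕ)
Ψ b []          = 0
Ψ b (i₁ ∷ rest) = sumL (L.map (λ t → b (t ∷ addLast (i₁ ∸ t ∸ 1) rest)) (range 1 (i₁ ∸ 1)))

lastToFront : ∀ {k} → Vec ℕ k → Vec ℕ k
lastToFront []       = []
lastToFront (x ∷ xs) = V.last (x ∷ xs) ∷ V.init (x ∷ xs)

Ω : ∀ {k} → (Vec ℕ k → ℕ) → (Vec ℕ k → ℕ)
Ω b iv = b (lastToFront iv)

module Submission where

-- Deleting the top
-- element N of a placement leaves a placement v of [N-1] and the slot p ≥ 1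
-- that N occupied, and every such pair arises (insertTop); hence
-- a^{(N)}_i = Σ_v #{p ≥ 1 : insertTop p v ∈ Ǎ^{(N)}_i} (count-by-insertion),
-- while Ω∘Ψ(a^{(N-1)})_i = Σ_v #{t : v ∈ Ǎ^{(N-1)}_{i'(t)}}.  For fixed v both
-- counts are 0 or 1 and agree (slots≡Ψ-terms): with N = r+k+1, the chains
-- of insertTop p v are those of v plus "N lies between r+k and r+1", which
-- keeps every old L-value; the new value L(r+k,N) = i_{k-1} picks out
-- exactly one slot (slotDist-hits-once), and the last condition then reads
-- L_v(r+1,r+2) = t.

open import Data.Nat using (ℕ; zero; suc; _+_; _*_; _∸_; _≤_; _<_; z≤n; s≤s; _≡ᵇ_; _<ᵇ_; _%_)
open import Data.Nat.Properties
open import Algebra.Properties.CommutativeSemigroup +-commutativeSemigroup using (interchange)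
open import Data.Nat.DivMod using ([m+n]%n≡m%n; m<n⇒m%n≡m; m%n<n; m%n%n≡m%n; %-distribˡ-+)
open import Data.Nat.Solver using (module +-*-Solver)
open +-*-Solver using (solve; _:+_; _:=_; con)
open import Data.Nat.ListAction using () renaming (sum to sumL)
open import Data.Bool using (Bool; true; false; _∧_; not; if_then_else_; T)
open import Data.Bool.Properties using (∧-identityʳ)
open import Data.Fin as F using (Fin; toℕ)
open import Data.Fin.Properties using (toℕ<n)
open import Data.List as L using (List; []; _∷_; length; allFin; concatMap; applyUpTo)
open import Data.List.Membership.Propositional as LM using ()
open import Data.List.Relation.Unary.Any using (here; there)
open import Data.Vec as V using (Vec; []; _∷_)
open import Data.Vec.Membership.Propositional as VM using ()
open import Data.Vec.Relation.Unary.Any using (here; there)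
open import Data.Vec.Relation.Unary.All using (All; []; _∷_)
open import Data.Product using (Σ; _×_; _,_; proj₁; proj₂)
open import Data.Sum using (_⊎_; inj₁; inj₂)
open import Data.Empty using (⊥; ⊥-elim)
open import Function using (_∘_)
open import Relation.Nullary using (¬_; yes; no)
open import Relation.Binary.PropositionalEquality
open import Relation.Binary.Definitions using (tri<; tri≈; tri>)
open import Defs

ind : Bool → ℕ
ind b = if b then 1 else 0

∑ : ∀ {A : Set} → List A → (A → ℕ) → ℕ
∑ [] f = 0
∑ (x ∷ xs) f = f x + ∑ xs f

module _ {A : Set} where
  ∑-cong : (xs : List A) {f g : A → ℕ} → (∀ x → f x ≡ g x) → ∑ xs f ≡ ∑ xs g
  ∑-cong [] e = refl
  ∑-cong (x ∷ xs) e = cong₂ _+_ (e x) (∑-cong xs e)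

  ∑-++ : (xs ys : List A) (f : A → ℕ) → ∑ (xs L.++ ys) f ≡ ∑ xs f + ∑ ys f
  ∑-++ [] ys f = refl
  ∑-++ (x ∷ xs) ys f = trans (cong (f x +_) (∑-++ xs ys f)) (sym (+-assoc (f x) _ _))

  ∑-+ : (xs : List A) (f g : A → ℕ) → ∑ xs (λ x → f x + g x) ≡ ∑ xs f + ∑ xs g
  ∑-+ [] f g = refl
  ∑-+ (x ∷ xs) f g =
    trans (cong (f x + g x +_) (∑-+ xs f g)) (interchange (f x) (g x) (∑ xs f) (∑ xs g))

  ∑-zero : (xs : List A) (f : A → ℕ) → (∀ x → f x ≡ 0) → ∑ xs f ≡ 0
  ∑-zero [] f e = refl
  ∑-zero (x ∷ xs) f e rewrite e x = ∑-zero xs f e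

  ∑-*ˡ : (xs : List A) (c : ℕ) (f : A → ℕ) → ∑ xs (λ x → c * f x) ≡ c * ∑ xs f
  ∑-*ˡ [] c f = sym (*-zeroʳ c)
  ∑-*ˡ (x ∷ xs) c f rewrite ∑-*ˡ xs c f = sym (*-distribˡ-+ c (f x) (∑ xs f))

  ∑-*ʳ : (xs : List A) (f : A → ℕ) (c : ℕ) → ∑ xs (λ x → f x * c) ≡ ∑ xs f * c
  ∑-*ʳ xs f c = trans (∑-cong xs (λ x → *-comm (f x) c)) (trans (∑-*ˡ xs c f) (*-comm c (∑ xs f)))

  length-filter : (q : A → Bool) (xs : List A) → length (L.filterᵇ q xs) ≡ ∑ xs (λ x → ind (q x))
  length-filter q [] = refl
  length-filter q (x ∷ xs) with q x
  ... | true = cong suc (length-filter q xs)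
  ... | false = length-filter q xs

  ∑-filter : (q : A → Bool) (xs : List A) (f : A → ℕ) → ∑ (L.filterᵇ q xs) f ≡ ∑ xs (λ x → ind (q x) * f x)
  ∑-filter q [] f = refl
  ∑-filter q (x ∷ xs) f with q x
  ... | true = cong₂ _+_ (sym (+-identityʳ (f x))) (∑-filter q xs f)
  ... | false = ∑-filter q xs f

  ∑-filter-cong : (q : A → Bool) (xs : List A) (f g : A → ℕ) → (∀ x → q x ≡ true → f x ≡ g x) →
    ∑ (L.filterᵇ q xs) f ≡ ∑ (L.filterᵇ q xs) g
  ∑-filter-cong q xs f g h = trans (∑-filter q xs f) (trans (∑-cong xs agree) (sym (∑-filter q xs g)))
    where
    agree : ∀ x → ind (q x) * f x ≡ ind (q x) * g x
    agree x with q x in e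
    ... | true = cong (_+ 0) (h x e)
    ... | false = refl

module _ {A B : Set} where
  ∑-map : (g : A → B) (xs : List A) (f : B → ℕ) → ∑ (L.map g xs) f ≡ ∑ xs (λ x → f (g x))
  ∑-map g [] f = refl
  ∑-map g (x ∷ xs) f = cong (f (g x) +_) (∑-map g xs f)

  ∑-concatMap : (g : A → List B) (xs : List A) (f : B → ℕ) → ∑ (concatMap g xs) f ≡ ∑ xs (λ x → ∑ (g x) f)
  ∑-concatMap g [] f = refl
  ∑-concatMap g (x ∷ xs) f = trans (∑-++ (g x) (concatMap g xs) f) (cong (∑ (g x) f +_) (∑-concatMap g xs f))

  ∑-swap : (xs : List A) (ys : List B) (f : A → B → ℕ) → ∑ xs (λ x → ∑ ys (f x)) ≡ ∑ ys (λ y → ∑ xs (λ x → f x y))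
  ∑-swap [] ys f = sym (∑-zero ys _ (λ _ → refl))
  ∑-swap (x ∷ xs) ys f = trans (cong (∑ ys (f x) +_) (∑-swap xs ys f)) (sym (∑-+ ys (f x) _))

countB≡∑ : (xs : List ℕ) (p : ℕ → Bool) → countB xs p ≡ ∑ xs (λ x → ind (p x))
countB≡∑ [] p = refl
countB≡∑ (x ∷ xs) p = cong (ind (p x) +_) (countB≡∑ xs p)

sumL-map≡∑ : ∀ {A : Set} (f : A → ℕ) (xs : List A) → sumL (L.map f xs) ≡ ∑ xs f
sumL-map≡∑ f [] = refl
sumL-map≡∑ f (x ∷ xs) = cong (f x +_) (sumL-map≡∑ f xs)


true≢false : true ≢ false
true≢false ()

Bool-ext : ∀ {a b : Bool} → (a ≡ true → b ≡ true) → (b ≡ true → a ≡ true) → a ≡ b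
Bool-ext {true} {true} f g = refl
Bool-ext {true} {false} f g = sym (f refl)
Bool-ext {false} {true} f g = g refl
Bool-ext {false} {false} f g = refl

∧-elimˡ : ∀ {a b} → a ∧ b ≡ true → a ≡ true
∧-elimˡ {true} e = refl

∧-elimʳ : ∀ {a b} → a ∧ b ≡ true → b ≡ true
∧-elimʳ {true} e = e

∧-intro : ∀ {a b} → a ≡ true → b ≡ true → a ∧ b ≡ true
∧-intro refl refl = refl

reassoc : ∀ a m q1 q2 → a ∧ (m ∧ (q1 ∧ q2)) ≡ (a ∧ (m ∧ q1)) ∧ q2
reassoc true true q1 q2 = refl
reassoc true false q1 q2 = refl
reassoc false m q1 q2 = refl

not-true⇒false : ∀ {a} → not a ≡ true → a ≡ false
not-true⇒false {false} e = refl

false⇒not-true : ∀ {a} → a ≡ false → not a ≡ true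
false⇒not-true refl = refl

not-false⇒true : ∀ {b} → not b ≡ false → b ≡ true
not-false⇒true {true} _ = refl

≡ᵇ-sound : ∀ {x y} → (x ≡ᵇ y) ≡ true → x ≡ y
≡ᵇ-sound {x} {y} e = ≡ᵇ⇒≡ x y (subst T (sym e) _)

≡ᵇ-complete : ∀ {x y} → x ≡ y → (x ≡ᵇ y) ≡ true
≡ᵇ-complete {zero} refl = refl
≡ᵇ-complete {suc x} refl = ≡ᵇ-complete {x} refl

≢⇒≡ᵇfalse : ∀ {x y} → x ≢ y → (x ≡ᵇ y) ≡ false
≢⇒≡ᵇfalse {x} {y} ne with x ≡ᵇ y in e
... | true = ⊥-elim (ne (≡ᵇ-sound e))
... | false = refl

≡ᵇfalse⇒≢ : ∀ {x y} → (x ≡ᵇ y) ≡ false → x ≢ y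
≡ᵇfalse⇒≢ {x} e refl = true≢false (trans (sym (≡ᵇ-complete {x} refl)) e)

≡ᵇ-sym : ∀ x y → (x ≡ᵇ y) ≡ (y ≡ᵇ x)
≡ᵇ-sym x y = Bool-ext (λ e → ≡ᵇ-complete (sym (≡ᵇ-sound {x} e))) (λ e → ≡ᵇ-complete (sym (≡ᵇ-sound {y} e)))

<ᵇ-sound : ∀ {x y} → (x <ᵇ y) ≡ true → x < y
<ᵇ-sound {x} {y} e = <ᵇ⇒< x y (subst T (sym e) _)

<ᵇ-complete : ∀ {x y} → x < y → (x <ᵇ y) ≡ true
<ᵇ-complete {x} {y} lt with x <ᵇ y | <⇒<ᵇ lt
... | true | _ = refl

n<ᵇn≡false : ∀ n → (n <ᵇ n) ≡ false
n<ᵇn≡false zero = refl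
n<ᵇn≡false (suc n) = n<ᵇn≡false n

ind-true : ∀ {b} → b ≡ true → ind b ≡ 1
ind-true refl = refl

ind-false : ∀ {b} → b ≡ false → ind b ≡ 0
ind-false refl = refl

ind-positive : ∀ {b} → 1 ≤ ind b → b ≡ true
ind-positive {true} _ = refl

ind≤1 : ∀ b → ind b ≤ 1
ind≤1 true = s≤s z≤n
ind≤1 false = z≤n

ind-∧ : ∀ a b → ind (a ∧ b) ≡ ind a * ind b
ind-∧ true b = sym (+-identityʳ (ind b))
ind-∧ false b = refl


interval : ℕ → ℕ → List ℕ
interval a zero = []
interval a (suc l) = a ∷ interval (suc a) l

applyUpTo≡interval : (g : ℕ → ℕ) (a n : ℕ) → (∀ i → g i ≡ a + i) → applyUpTo g n ≡ interval a n
applyUpTo≡interval g a zero e = refl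
applyUpTo≡interval g a (suc n) e = cong₂ _∷_ (trans (e 0) (+-identityʳ a)) (applyUpTo≡interval (λ i → g (suc i)) (suc a) n (λ i → trans (e (suc i)) (+-suc a i)))

map-applyUpTo : (h g : ℕ → ℕ) (n : ℕ) → L.map h (applyUpTo g n) ≡ applyUpTo (λ i → h (g i)) n
map-applyUpTo h g zero = refl
map-applyUpTo h g (suc n) = cong (h (g 0) ∷_) (map-applyUpTo h (λ i → g (suc i)) n)

range≡interval : (a b : ℕ) → range a b ≡ interval a (suc b ∸ a)
range≡interval a b = trans (map-applyUpTo (a +_) (λ i → i) (suc b ∸ a)) (applyUpTo≡interval (a +_) a _ (λ i → refl))

range0≡interval : ∀ m → range 0 m ≡ interval 0 (suc m)
range0≡interval m = range≡interval 0 m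

range1≡interval : ∀ K → range 1 (suc K) ≡ interval 1 (suc K)
range1≡interval K = range≡interval 1 (suc K)

interval-snoc : ∀ a l → interval a (suc l) ≡ interval a l L.++ ((a + l) ∷ [])
interval-snoc a zero = cong (_∷ []) (sym (+-identityʳ a))
interval-snoc a (suc l) = cong (a ∷_) (trans (interval-snoc (suc a) l) (cong (λ z → interval (suc a) l L.++ (z ∷ [])) (sym (+-suc a l))))

interval-member< : ∀ a l {x} → x LM.∈ interval a l → x < a + l
interval-member< a (suc l) (here refl) = m<m+n a (s≤s z≤n)
interval-member< a (suc l) {x} (there m) = subst (x <_) (sym (+-suc a l)) (interval-member< (suc a) l m)

∑-interval-cong : ∀ a l {f g : ℕ → ℕ} → (∀ x → a ≤ x → x < a + l → f x ≡ g x) → ∑ (interval a l) f ≡ ∑ (interval a l) g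
∑-interval-cong a zero e = refl
∑-interval-cong a (suc l) e = cong₂ _+_ (e a ≤-refl (m<m+n a (s≤s z≤n))) (∑-interval-cong (suc a) l (λ x ax xl → e x (<⇒≤ ax) (subst (x <_) (sym (+-suc a l)) xl)))

∑-interval-shift : ∀ a l (f : ℕ → ℕ) → ∑ (interval (suc a) l) f ≡ ∑ (interval a l) (λ x → f (suc x))
∑-interval-shift a zero f = refl
∑-interval-shift a (suc l) f = cong (f (suc a) +_) (∑-interval-shift (suc a) l f)

∑-interval-snoc : ∀ a l (f : ℕ → ℕ) → ∑ (interval a (suc l)) f ≡ ∑ (interval a l) f + f (a + l)
∑-interval-snoc a l f = trans (cong (λ z → ∑ z f) (interval-snoc a l)) (trans (∑-++ (interval a l) _ f) (cong (∑ (interval a l) f +_) (+-identityʳ _)))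

∑-interval-point : ∀ a l c (g : ℕ → ℕ) → a ≤ c → c < a + l → ∑ (interval a l) (λ x → ind (x ≡ᵇ c) * g x) ≡ g c
∑-interval-point a zero c g ac cl = ⊥-elim (<-irrefl refl (≤-<-trans ac (subst (c <_) (+-identityʳ a) cl)))
∑-interval-point a (suc l) c g ac cl with m≤n⇒m<n∨m≡n ac
... | inj₂ refl rewrite ≡ᵇ-complete {a} refl = trans (cong₂ _+_ (+-identityʳ (g a)) (∑-interval-cong (suc a) l (λ x ax _ → cong (λ z → ind z * g x) (≢⇒≡ᵇfalse (λ e → <-irrefl (sym e) ax))))) (trans (cong (g a +_) (∑-zero (interval (suc a) l) (λ _ → 0) (λ _ → refl))) (+-identityʳ (g a)))
... | inj₁ ac' rewrite ≢⇒≡ᵇfalse {a} {c} (λ e → <-irrefl e ac') = ∑-interval-point (suc a) l c g ac' (subst (c <_) (+-suc a l) cl)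

∑-interval-outside : ∀ a l c (g : ℕ → ℕ) → ¬ (a ≤ c × c < a + l) → ∑ (interval a l) (λ x → ind (x ≡ᵇ c) * g x) ≡ 0
∑-interval-outside a l c g n = trans (∑-interval-cong a l (λ x ax xl → cong (λ z → ind z * g x) (≢⇒≡ᵇfalse (λ e → n (subst (λ z → a ≤ z × z < a + l) e (ax , xl)))))) (∑-zero (interval a l) (λ _ → 0) (λ _ → refl))

∑-interval-≤ : ∀ a l (f : ℕ → ℕ) → (∀ x → f x ≤ 1) → ∑ (interval a l) f ≤ l
∑-interval-≤ a zero f h = z≤n
∑-interval-≤ a (suc l) f h = +-mono-≤ (h a) (∑-interval-≤ (suc a) l f h)

∑-interval-atMostOne : ∀ a l (f : ℕ → ℕ) → (∀ x → f x ≤ 1) →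
  (∀ x y → a ≤ x → x < a + l → a ≤ y → y < a + l → 1 ≤ f x → 1 ≤ f y → x ≡ y) → ∑ (interval a l) f ≤ 1
∑-interval-atMostOne a zero f b u = z≤n
∑-interval-atMostOne a (suc l) f b u with f a in fa
... | zero = ∑-interval-atMostOne (suc a) l f b (λ x y ax xl ay yl fx fy → u x y (<⇒≤ ax) (sub xl) (<⇒≤ ay) (sub yl) fx fy)
  where sub : ∀ {z} → z < suc a + l → z < a + suc l
        sub {z} = subst (z <_) (sym (+-suc a l))
... | suc w = ≤-trans (≤-reflexive (cong (suc w +_) rest0)) (≤-trans (≤-reflexive (+-identityʳ (suc w))) (subst (_≤ 1) fa (b a)))
  where
  rest0 : ∑ (interval (suc a) l) f ≡ 0
  rest0 = trans (∑-interval-cong (suc a) l {f} {λ _ → 0} (λ x ax xl → n≤0⇒n≡0 (≮⇒≥ (λ fx → <-irrefl (u a x ≤-refl (m<m+n a (s≤s z≤n)) (<⇒≤ ax) (subst (x <_) (sym (+-suc a l)) xl) (subst (1 ≤_) (sym fa) (s≤s z≤n)) fx) ax)))) (∑-zero (interval (suc a) l) _ (λ _ → refl))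

∑-interval-allOne : ∀ a l (f : ℕ → ℕ) → (∀ x → f x ≤ 1) → ∑ (interval a l) f ≡ l → ∀ x → a ≤ x → x < a + l → f x ≡ 1
∑-interval-allOne a zero f b e x ax xl = ⊥-elim (<-irrefl refl (≤-<-trans ax (subst (x <_) (+-identityʳ a) xl)))
∑-interval-allOne a (suc l) f b e x ax xl = go (m≤n⇒m<n∨m≡n ax)
  where
  fa1 : f a ≡ 1
  fa1 = ≤-antisym (b a) (≮⇒≥ (λ fa0 → <-irrefl e (≤-<-trans (+-mono-≤ (≤-pred fa0) (∑-interval-≤ (suc a) l f b)) (n<1+n l))))
  rest : ∑ (interval (suc a) l) f ≡ l
  rest = +-cancelˡ-≡ 1 _ _ (trans (cong (_+ ∑ (interval (suc a) l) f) (sym fa1)) e)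
  go : a < x ⊎ a ≡ x → f x ≡ 1
  go (inj₂ refl) = fa1
  go (inj₁ ax') = ∑-interval-allOne (suc a) l f b rest x ax' (subst (x <_) (+-suc a l) xl)

∑-interval-const1 : ∀ a l → ∑ (interval a l) (λ _ → 1) ≡ l
∑-interval-const1 a zero = refl
∑-interval-const1 a (suc l) = cong suc (∑-interval-const1 (suc a) l)

-- Reindexing a sum over [0, M) along an injective self-map f.  Each value
-- s is hit at most once (injectivity) and the hits add up to M, so each s is
-- hit exactly once; this is the form in which we compare counts of points.
∑-permute : ∀ M (f g : ℕ → ℕ) → (∀ x → x < M → f x < M) → (∀ x y → x < M → y < M → f x ≡ f y → x ≡ y) →
  ∑ (interval 0 M) (λ x → g (f x)) ≡ ∑ (interval 0 M) g
∑-permute M f g fb finj = begin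
  ∑ R (λ h → g (f h))
    ≡⟨ ∑-interval-cong 0 M (λ h _ hl → sym (∑-interval-point 0 M (f h) g z≤n (fb h hl))) ⟩
  ∑ R (λ h → ∑ R (λ s → ind (s ≡ᵇ f h) * g s))
    ≡⟨ ∑-swap R R (λ h s → ind (s ≡ᵇ f h) * g s) ⟩
  ∑ R (λ s → ∑ R (λ h → ind (s ≡ᵇ f h) * g s))
    ≡⟨ ∑-cong R (λ s → trans (∑-cong R (λ h → *-comm (ind (s ≡ᵇ f h)) (g s))) (∑-*ˡ R (g s) (λ h → ind (s ≡ᵇ f h)))) ⟩
  ∑ R (λ s → g s * c s)
    ≡⟨ ∑-interval-cong 0 M (λ s _ sl → trans (cong (g s *_) (c1 s sl)) (*-identityʳ (g s))) ⟩
  ∑ R g ∎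
  where
  open ≡-Reasoning
  R = interval 0 M
  c : ℕ → ℕ
  c s = ∑ R (λ h → ind (s ≡ᵇ f h))
  cb : ∀ s → c s ≤ 1
  cb s = ∑-interval-atMostOne 0 M (λ h → ind (s ≡ᵇ f h)) (λ h → ind≤1 _)
    (λ x y _ xl _ yl fx fy → finj x y xl yl (trans (sym (≡ᵇ-sound {s} (ind-positive fx))) (≡ᵇ-sound {s} (ind-positive fy))))
  total : ∑ R c ≡ M
  total = begin
    ∑ R c ≡⟨ sym (∑-swap R R (λ h s → ind (s ≡ᵇ f h))) ⟩
    ∑ R (λ h → ∑ R (λ s → ind (s ≡ᵇ f h)))
      ≡⟨ ∑-interval-cong 0 M (λ h _ hl → trans (∑-interval-cong 0 M (λ s _ _ → sym (*-identityʳ _))) (∑-interval-point 0 M (f h) (λ _ → 1) z≤n (fb h hl))) ⟩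
    ∑ R (λ _ → 1) ≡⟨ ∑-interval-const1 0 M ⟩
    M ∎
  c1 : ∀ s → s < M → c s ≡ 1
  c1 s sl = ∑-interval-allOne 0 M c cb total s z≤n sl

count-below : ∀ a l D → a ≤ D → D ≤ a + l → ∑ (interval a l) (λ e → ind (e <ᵇ D)) ≡ D ∸ a
count-below a zero D aD Dl = sym (trans (cong (_∸ a) (≤-antisym Dl' aD)) (n∸n≡0 a))
  where Dl' : D ≤ a
        Dl' = subst (D ≤_) (+-identityʳ a) Dl
count-below a (suc l) D aD Dl with m≤n⇒m<n∨m≡n aD
... | inj₁ aD' rewrite <ᵇ-complete aD' = trans (cong suc (count-below (suc a) l D aD' (subst (D ≤_) (+-suc a l) Dl))) (sym (+-∸-assoc 1 aD'))
... | inj₂ refl = trans (cong₂ _+_ (ind-false (n<ᵇn≡false a)) (trans (∑-interval-cong (suc a) l (λ e ae _ → ind-false (above ae))) (∑-zero (interval (suc a) l) (λ _ → 0) (λ _ → refl)))) (sym (n∸n≡0 a))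
  where above : ∀ {e} → a < e → (e <ᵇ a) ≡ false
        above {e} ae with e <ᵇ a in q
        ... | true = ⊥-elim (<-asym ae (<ᵇ-sound q))
        ... | false = refl


allB≡ : ∀ {xs ys} (p : ℕ → Bool) → xs ≡ ys → allB xs p ≡ allB ys p
allB≡ p e = cong (λ z → allB z p) e

allB-++ : ∀ xs ys (p : ℕ → Bool) → allB (xs L.++ ys) p ≡ allB xs p ∧ allB ys p
allB-++ [] ys p = refl
allB-++ (x ∷ xs) ys p with p x
... | true = allB-++ xs ys p
... | false = refl

allB-last : ∀ a l (p : ℕ → Bool) → allB (interval a (suc l)) p ≡ allB (interval a l) p ∧ p (a + l)
allB-last a l p = trans (allB≡ p (interval-snoc a l)) (trans (allB-++ (interval a l) _ p) (cong (allB (interval a l) p ∧_) (∧-identityʳ (p (a + l)))))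

allB-shift : ∀ a l (p : ℕ → Bool) → allB (interval (suc a) l) p ≡ allB (interval a l) (λ x → p (suc x))
allB-shift a zero p = refl
allB-shift a (suc l) p = cong (p (suc a) ∧_) (allB-shift (suc a) l p)

allB-interval-cong : ∀ a l {p q : ℕ → Bool} → (∀ x → a ≤ x → x < a + l → p x ≡ q x) → allB (interval a l) p ≡ allB (interval a l) q
allB-interval-cong a zero h = refl
allB-interval-cong a (suc l) h = cong₂ _∧_ (h a ≤-refl (m<m+n a (s≤s z≤n))) (allB-interval-cong (suc a) l (λ x ax xl → h x (<⇒≤ ax) (subst (x <_) (sym (+-suc a l)) xl)))

allB-interval-sound : ∀ a l {p} → allB (interval a l) p ≡ true → ∀ x → a ≤ x → x < a + l → p x ≡ true
allB-interval-sound a zero e x ax xl = ⊥-elim (<-irrefl refl (≤-<-trans ax (subst (x <_) (+-identityʳ a) xl)))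
allB-interval-sound a (suc l) {p} e x ax xl with m≤n⇒m<n∨m≡n ax
... | inj₂ refl = ∧-elimˡ e
... | inj₁ ax' = allB-interval-sound (suc a) l {p} (∧-elimʳ {p a} e) x ax' (subst (x <_) (+-suc a l) xl)

allB-interval-complete : ∀ a l {p} → (∀ x → a ≤ x → x < a + l → p x ≡ true) → allB (interval a l) p ≡ true
allB-interval-complete a zero h = refl
allB-interval-complete a (suc l) h = ∧-intro (h a ≤-refl (m<m+n a (s≤s z≤n))) (allB-interval-complete (suc a) l (λ x ax xl → h x (<⇒≤ ax) (subst (x <_) (sym (+-suc a l)) xl)))

allB-range0-sound : ∀ m {p : ℕ → Bool} → allB (range 0 m) p ≡ true → ∀ x → x ≤ m → p x ≡ true
allB-range0-sound m {p} e x xm = allB-interval-sound 0 (suc m) {p} (subst (λ r → allB r p ≡ true) (range0≡interval m) e) x z≤n (s≤s xm)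

allB-false-witness : ∀ xs {p : ℕ → Bool} → allB xs p ≡ false → Σ ℕ (λ x → (x LM.∈ xs) × p x ≡ false)
allB-false-witness (x ∷ xs) {p} e with p x in px
... | false = x , here refl , px
... | true with allB-false-witness xs e
... | (y , m , q) = y , there m , q

allB-range0-false-witness : ∀ m {p : ℕ → Bool} → allB (range 0 m) p ≡ false → Σ ℕ (λ x → x ≤ m × p x ≡ false)
allB-range0-false-witness m {p} e with allB-false-witness (interval 0 (suc m)) {p} (subst (λ r → allB r p ≡ false) (range0≡interval m) e)
... | (x , xm , ex) = x , ≤-pred (interval-member< 0 (suc m) xm) , ex


∑Fin : (n : ℕ) → (Fin n → ℕ) → ℕ
∑Fin zero G = 0
∑Fin (suc n) G = G F.zero + ∑Fin n (λ i → G (F.suc i))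

∑-tabulate : ∀ {B : Set} (n : ℕ) (h : Fin n → B) (G : B → ℕ) → ∑ (L.tabulate h) G ≡ ∑Fin n (λ i → G (h i))
∑-tabulate zero h G = refl
∑-tabulate (suc n) h G = cong (G (h F.zero) +_) (∑-tabulate n (λ i → h (F.suc i)) G)

∑-allFin : (n : ℕ) (G : Fin n → ℕ) → ∑ (allFin n) G ≡ ∑Fin n G
∑-allFin n G = ∑-tabulate n (λ i → i) G

∑-allFin-toℕ : ∀ n (f : ℕ → ℕ) → ∑ (allFin n) (λ p → f (toℕ p)) ≡ ∑ (interval 0 n) f
∑-allFin-toℕ n f = trans (∑-allFin n (λ p → f (toℕ p))) (go n f)
  where
  go : ∀ n (f : ℕ → ℕ) → ∑Fin n (λ p → f (toℕ p)) ≡ ∑ (interval 0 n) f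
  go zero f = refl
  go (suc n) f = cong (f 0 +_) (trans (go n (λ x → f (suc x))) (sym (∑-interval-shift 0 n f)))

∑Fin-punchIn : (M : ℕ) (p : Fin (suc M)) (G : Fin (suc M) → ℕ) → G p ≡ 0 → ∑Fin (suc M) G ≡ ∑Fin M (λ i → G (F.punchIn p i))
∑Fin-punchIn M F.zero G e rewrite e = refl
∑Fin-punchIn (suc M) (F.suc p) G e = cong (G F.zero +_) (∑Fin-punchIn M p (λ i → G (F.suc i)) e)

∑-allVecs-snoc : (M n : ℕ) (G : Vec (Fin M) (suc n) → ℕ) →
  ∑ (allVecs M (suc n)) G ≡ ∑ (allVecs M n) (λ v → ∑ (allFin M) (λ f → G (v V.∷ʳ f)))
∑-allVecs-snoc M zero G = trans (∑-concatMap _ (allFin M) G) (trans (∑-cong (allFin M) (λ f → +-identityʳ (G (f ∷ [])))) (sym (+-identityʳ _)))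
∑-allVecs-snoc M (suc n) G = begin
  ∑ (allVecs M (suc (suc n))) G
    ≡⟨ ∑-concatMap _ (allFin M) G ⟩
  ∑ (allFin M) (λ g → ∑ (L.map (g ∷_) (allVecs M (suc n))) G)
    ≡⟨ ∑-cong (allFin M) (λ g → ∑-map (g ∷_) (allVecs M (suc n)) G) ⟩
  ∑ (allFin M) (λ g → ∑ (allVecs M (suc n)) (λ w → G (g ∷ w)))
    ≡⟨ ∑-cong (allFin M) (λ g → ∑-allVecs-snoc M n (λ w → G (g ∷ w))) ⟩
  ∑ (allFin M) (λ g → ∑ (allVecs M n) (λ v → ∑ (allFin M) (λ f → G (g ∷ (v V.∷ʳ f)))))
    ≡⟨ sym (∑-cong (allFin M) (λ g → ∑-map (g ∷_) (allVecs M n) _)) ⟩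
  ∑ (allFin M) (λ g → ∑ (L.map (g ∷_) (allVecs M n)) (λ v → ∑ (allFin M) (λ f → G (v V.∷ʳ f))))
    ≡⟨ sym (∑-concatMap _ (allFin M) _) ⟩
  ∑ (allVecs M (suc n)) (λ v → ∑ (allFin M) (λ f → G (v V.∷ʳ f))) ∎
  where open ≡-Reasoning

∑-allVecs-punchIn : (M n : ℕ) (p : Fin (suc M)) (G : Vec (Fin (suc M)) n → ℕ) →
  (∀ v → p VM.∈ v → G v ≡ 0) →
  ∑ (allVecs (suc M) n) G ≡ ∑ (allVecs M n) (λ v → G (V.map (F.punchIn p) v))
∑-allVecs-punchIn M zero p G z = refl
∑-allVecs-punchIn M (suc n) p G z = begin
  ∑ (allVecs (suc M) (suc n)) G
    ≡⟨ ∑-concatMap (λ f → L.map (f ∷_) (allVecs (suc M) n)) (allFin (suc M)) G ⟩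
  ∑ (allFin (suc M)) (λ g → ∑ (L.map (g ∷_) (allVecs (suc M) n)) G)
    ≡⟨ ∑-cong (allFin (suc M)) (λ g → ∑-map (g ∷_) (allVecs (suc M) n) G) ⟩
  ∑ (allFin (suc M)) (λ g → ∑ (allVecs (suc M) n) (λ w → G (g ∷ w)))
    ≡⟨ ∑-allFin (suc M) (λ g → ∑ (allVecs (suc M) n) (λ w → G (g ∷ w))) ⟩
  ∑Fin (suc M) (λ g → ∑ (allVecs (suc M) n) (λ w → G (g ∷ w)))
    ≡⟨ ∑Fin-punchIn M p (λ g → ∑ (allVecs (suc M) n) (λ w → G (g ∷ w))) (∑-zero (allVecs (suc M) n) (λ w → G (p ∷ w)) (λ w → z (p ∷ w) (here refl))) ⟩
  ∑Fin M (λ g → ∑ (allVecs (suc M) n) (λ w → G (F.punchIn p g ∷ w)))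
    ≡⟨ sym (∑-allFin M (λ g → ∑ (allVecs (suc M) n) (λ w → G (F.punchIn p g ∷ w)))) ⟩
  ∑ (allFin M) (λ g → ∑ (allVecs (suc M) n) (λ w → G (F.punchIn p g ∷ w)))
    ≡⟨ ∑-cong (allFin M) (λ g → ∑-allVecs-punchIn M n p (λ w → G (F.punchIn p g ∷ w)) (λ v pv → z _ (there pv))) ⟩
  ∑ (allFin M) (λ g → ∑ (allVecs M n) (λ w → G (F.punchIn p g ∷ V.map (F.punchIn p) w)))
    ≡⟨ sym (∑-cong (allFin M) (λ g → ∑-map (g ∷_) (allVecs M n) _)) ⟩
  ∑ (allFin M) (λ g → ∑ (L.map (g ∷_) (allVecs M n)) (λ v → G (V.map (F.punchIn p) v)))
    ≡⟨ sym (∑-concatMap (λ f → L.map (f ∷_) (allVecs M n)) (allFin M) (λ v → G (V.map (F.punchIn p) v))) ⟩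
  ∑ (allVecs M (suc n)) (λ v → G (V.map (F.punchIn p) v)) ∎
  where open ≡-Reasoning


-- The cyclic betweenness relation on ℕ: Cyclic a b c says that b lies
-- strictly between a and c when counting upward from a and wrapping
-- around; it is the cyclic order of the slots of a placement.

Cyclic : ℕ → ℕ → ℕ → Set
Cyclic a b c = (a < b × b < c) ⊎ (b < c × c < a) ⊎ (c < a × a < b)

cyclic-rotate : ∀ {a b c} → Cyclic a b c → Cyclic b c a
cyclic-rotate (inj₁ x) = inj₂ (inj₂ x)
cyclic-rotate (inj₂ (inj₁ x)) = inj₁ x
cyclic-rotate (inj₂ (inj₂ x)) = inj₂ (inj₁ x)

cyclic-asym : ∀ {a b c} → Cyclic a b c → ¬ Cyclic a c b
cyclic-asym (inj₁ (ab , bc)) (inj₁ (ac , cb)) = <-asym bc cb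
cyclic-asym (inj₁ (ab , bc)) (inj₂ (inj₁ (cb , ba))) = <-asym bc cb
cyclic-asym (inj₁ (ab , bc)) (inj₂ (inj₂ (ba , ac))) = <-asym ab ba
cyclic-asym (inj₂ (inj₁ (bc , ca))) (inj₁ (ac , cb)) = <-asym bc cb
cyclic-asym (inj₂ (inj₁ (bc , ca))) (inj₂ (inj₁ (cb , ba))) = <-asym bc cb
cyclic-asym (inj₂ (inj₁ (bc , ca))) (inj₂ (inj₂ (ba , ac))) = <-asym ca ac
cyclic-asym (inj₂ (inj₂ (ca , ab))) (inj₁ (ac , cb)) = <-asym ca ac
cyclic-asym (inj₂ (inj₂ (ca , ab))) (inj₂ (inj₁ (cb , ba))) = <-asym ab ba
cyclic-asym (inj₂ (inj₂ (ca , ab))) (inj₂ (inj₂ (ba , ac))) = <-asym ca ac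

cyclic-total : ∀ a b c → a ≢ b → b ≢ c → a ≢ c → Cyclic a b c ⊎ Cyclic a c b
cyclic-total a b c ab bc ac with <-cmp a b | <-cmp b c | <-cmp a c
... | tri≈ _ e _ | _ | _ = ⊥-elim (ab e)
... | _ | tri≈ _ e _ | _ = ⊥-elim (bc e)
... | _ | _ | tri≈ _ e _ = ⊥-elim (ac e)
... | tri< x _ _ | tri< y _ _ | _ = inj₁ (inj₁ (x , y))
... | tri< x _ _ | tri> _ _ y | tri< z _ _ = inj₂ (inj₁ (z , y))
... | tri< x _ _ | tri> _ _ y | tri> _ _ z = inj₁ (inj₂ (inj₂ (z , x)))
... | tri> _ _ x | tri< y _ _ | tri< z _ _ = inj₂ (inj₂ (inj₂ (x , z)))
... | tri> _ _ x | tri< y _ _ | tri> _ _ z = inj₁ (inj₂ (inj₁ (y , z)))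
... | tri> _ _ x | tri> _ _ y | _ = inj₂ (inj₂ (inj₁ (y , x)))

cyclic-trans₁ : ∀ {a b c d} → Cyclic a b c → Cyclic a c d → Cyclic a b d
cyclic-trans₁ (inj₁ (ab , bc)) (inj₁ (ac , cd)) = inj₁ (ab , <-trans bc cd)
cyclic-trans₁ (inj₁ (ab , bc)) (inj₂ (inj₁ (cd , da))) = ⊥-elim (<-asym (<-trans ab bc) (<-trans cd da))
cyclic-trans₁ (inj₁ (ab , bc)) (inj₂ (inj₂ (da , ac))) = inj₂ (inj₂ (da , ab))
cyclic-trans₁ (inj₂ (inj₁ (bc , ca))) (inj₁ (ac , cd)) = ⊥-elim (<-asym ac ca)
cyclic-trans₁ (inj₂ (inj₁ (bc , ca))) (inj₂ (inj₁ (cd , da))) = inj₂ (inj₁ (<-trans bc cd , da))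
cyclic-trans₁ (inj₂ (inj₁ (bc , ca))) (inj₂ (inj₂ (da , ac))) = ⊥-elim (<-asym ac ca)
cyclic-trans₁ (inj₂ (inj₂ (ca , ab))) (inj₁ (ac , cd)) = ⊥-elim (<-asym ac ca)
cyclic-trans₁ (inj₂ (inj₂ (ca , ab))) (inj₂ (inj₁ (cd , da))) = inj₂ (inj₂ (da , ab))
cyclic-trans₁ (inj₂ (inj₂ (ca , ab))) (inj₂ (inj₂ (da , ac))) = ⊥-elim (<-asym ac ca)

cyclic-trans₂ : ∀ {a b c d} → Cyclic a b c → Cyclic a c d → Cyclic b c d
cyclic-trans₂ (inj₁ (ab , bc)) (inj₁ (ac , cd)) = inj₁ (bc , cd)
cyclic-trans₂ (inj₁ (ab , bc)) (inj₂ (inj₁ (cd , da))) = ⊥-elim (<-asym (<-trans ab bc) (<-trans cd da))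
cyclic-trans₂ (inj₁ (ab , bc)) (inj₂ (inj₂ (da , ac))) = inj₂ (inj₂ (<-trans da ab , bc))
cyclic-trans₂ (inj₂ (inj₁ (bc , ca))) (inj₁ (ac , cd)) = ⊥-elim (<-asym ac ca)
cyclic-trans₂ (inj₂ (inj₁ (bc , ca))) (inj₂ (inj₁ (cd , da))) = inj₁ (bc , cd)
cyclic-trans₂ (inj₂ (inj₁ (bc , ca))) (inj₂ (inj₂ (da , ac))) = ⊥-elim (<-asym ac ca)
cyclic-trans₂ (inj₂ (inj₂ (ca , ab))) (inj₁ (ac , cd)) = ⊥-elim (<-asym ac ca)
cyclic-trans₂ (inj₂ (inj₂ (ca , ab))) (inj₂ (inj₁ (cd , da))) = inj₂ (inj₁ (cd , <-trans da ab))
cyclic-trans₂ (inj₂ (inj₂ (ca , ab))) (inj₂ (inj₂ (da , ac))) = ⊥-elim (<-asym ac ca)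

cyclic-above : ∀ {a b c} → a < b → a < c → Cyclic a b c → b < c
cyclic-above ab ac (inj₁ (_ , bc)) = bc
cyclic-above ab ac (inj₂ (inj₁ (_ , ca))) = ⊥-elim (<-asym ac ca)
cyclic-above ab ac (inj₂ (inj₂ (ca , _))) = ⊥-elim (<-asym ac ca)


-- punchIn on ℕ: the order embedding that skips the value p; inserting a
-- new slot p into a placement moves every old slot q to punchInℕ p q.

punchInℕ : ℕ → ℕ → ℕ
punchInℕ p q = if q <ᵇ p then q else suc q

toℕ-punchIn : ∀ {n} (p : Fin (suc n)) (j : Fin n) → toℕ (F.punchIn p j) ≡ punchInℕ (toℕ p) (toℕ j)
toℕ-punchIn F.zero j with toℕ j
... | zero = refl
... | suc _ = refl
toℕ-punchIn (F.suc p) F.zero = refl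
toℕ-punchIn (F.suc p) (F.suc j) with toℕ-punchIn p j
... | e with toℕ j <ᵇ toℕ p
... | true = cong suc e
... | false = cong suc e

punchInℕ-below : ∀ {p q} → q < p → punchInℕ p q ≡ q
punchInℕ-below {p} {q} h rewrite <ᵇ-complete h = refl

punchInℕ-above : ∀ {p q} → p ≤ q → punchInℕ p q ≡ suc q
punchInℕ-above {p} {q} h with q <ᵇ p in e
... | true = ⊥-elim (<⇒≱ (<ᵇ-sound e) h)
... | false = refl

punchInℕ-cases : ∀ p q → (q < p × punchInℕ p q ≡ q) ⊎ (p ≤ q × punchInℕ p q ≡ suc q)
punchInℕ-cases p q with <-cmp q p
... | tri< x _ _ = inj₁ (x , punchInℕ-below x)
... | tri≈ _ e _ = inj₂ (≤-reflexive (sym e) , punchInℕ-above (≤-reflexive (sym e)))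
... | tri> _ _ x = inj₂ (<⇒≤ x , punchInℕ-above (<⇒≤ x))

punchInℕ-mono : ∀ p {x y} → x < y → punchInℕ p x < punchInℕ p y
punchInℕ-mono p {x} {y} xy with punchInℕ-cases p x | punchInℕ-cases p y
... | inj₁ (_ , ex) | inj₁ (_ , ey) rewrite ex | ey = xy
... | inj₁ (_ , ex) | inj₂ (_ , ey) rewrite ex | ey = <-trans xy (n<1+n y)
... | inj₂ (px , ex) | inj₁ (yp , ey) = ⊥-elim (<-irrefl refl (<-trans (≤-<-trans px xy) yp))
... | inj₂ (_ , ex) | inj₂ (_ , ey) rewrite ex | ey = s≤s xy

punchInℕ-injective : ∀ p {x y} → punchInℕ p x ≡ punchInℕ p y → x ≡ y
punchInℕ-injective p {x} {y} e with <-cmp x y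
... | tri< xy _ _ = ⊥-elim (<-irrefl e (punchInℕ-mono p xy))
... | tri≈ _ q _ = q
... | tri> _ _ yx = ⊥-elim (<-irrefl (sym e) (punchInℕ-mono p yx))

punchInℕ-≢ : ∀ p q → punchInℕ p q ≢ p
punchInℕ-≢ p q e with punchInℕ-cases p q
... | inj₁ (qp , ex) = <-irrefl (trans (sym ex) e) qp
... | inj₂ (pq , ex) = <-irrefl (sym (trans (sym ex) e)) (s≤s pq)

punchInℕ-reflects-< : ∀ p {x y} → punchInℕ p x < punchInℕ p y → x < y
punchInℕ-reflects-< p {x} {y} h with <-cmp x y
... | tri< xy _ _ = xy
... | tri≈ _ refl _ = ⊥-elim (<-irrefl refl h)
... | tri> _ _ yx = ⊥-elim (<-asym h (punchInℕ-mono p yx))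

punchInℕ-preserves-cyclic : ∀ p {a b c} → Cyclic a b c → Cyclic (punchInℕ p a) (punchInℕ p b) (punchInℕ p c)
punchInℕ-preserves-cyclic p (inj₁ (x , y)) = inj₁ (punchInℕ-mono p x , punchInℕ-mono p y)
punchInℕ-preserves-cyclic p (inj₂ (inj₁ (x , y))) = inj₂ (inj₁ (punchInℕ-mono p x , punchInℕ-mono p y))
punchInℕ-preserves-cyclic p (inj₂ (inj₂ (x , y))) = inj₂ (inj₂ (punchInℕ-mono p x , punchInℕ-mono p y))

punchInℕ-reflects-cyclic : ∀ p {a b c} → Cyclic (punchInℕ p a) (punchInℕ p b) (punchInℕ p c) → Cyclic a b c
punchInℕ-reflects-cyclic p (inj₁ (x , y)) = inj₁ (punchInℕ-reflects-< p x , punchInℕ-reflects-< p y)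
punchInℕ-reflects-cyclic p (inj₂ (inj₁ (x , y))) = inj₂ (inj₁ (punchInℕ-reflects-< p x , punchInℕ-reflects-< p y))
punchInℕ-reflects-cyclic p (inj₂ (inj₂ (x , y))) = inj₂ (inj₂ (punchInℕ-reflects-< p x , punchInℕ-reflects-< p y))

punchInℕ≡0 : ∀ {p q} → punchInℕ p q ≡ 0 → q ≡ 0 × 0 < p
punchInℕ≡0 {p} {q} e with punchInℕ-cases p q
... | inj₁ (qp , ex) = trans (sym ex) e , ≤-<-trans z≤n qp
... | inj₂ (_ , ex) with trans (sym ex) e
... | ()


cwDist-forward : ∀ m a b → a ≤ b → b ≤ m → cwDist m a b ≡ b ∸ a
cwDist-forward m a b ab bm = trans (cong (_% suc m) (+-∸-comm (suc m) ab)) (trans ([m+n]%n≡m%n (b ∸ a) (suc m)) (m<n⇒m%n≡m (s≤s (≤-trans (m∸n≤m b a) bm))))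

cwDist-backward : ∀ m a b → b < a → a ≤ m → cwDist m a b ≡ b + suc m ∸ a
cwDist-backward m a b ba am = m<n⇒m%n≡m lt
  where
  lt : b + suc m ∸ a < suc m
  lt = subst (b + suc m ∸ a <_) (m+n∸n≡m (suc m) a)
         (∸-monoˡ-< (subst (_< suc m + a) (+-comm (suc m) b) (+-monoʳ-< (suc m) ba))
                    (≤-trans am (≤-trans (n≤1+n m) (m≤n+m (suc m) b))))

∸-cancel-< : ∀ {x y z} → x ∸ z < y ∸ z → x < y
∸-cancel-< {x} {y} {z} h = ≰⇒> (λ yx → <⇒≱ h (∸-monoˡ-≤ z yx))

cwDist<⇒cyclic : ∀ m a b c → a ≤ m → b ≤ m → c ≤ m → a ≢ b → a ≢ c →
  cwDist m a b < cwDist m a c → Cyclic a b c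
cwDist<⇒cyclic m a b c am bm cm ab ac h with <-cmp a b | <-cmp a c
... | tri≈ _ e _ | _ = ⊥-elim (ab e)
... | _ | tri≈ _ e _ = ⊥-elim (ac e)
... | tri< a<b _ _ | tri< a<c _ _ rewrite cwDist-forward m a b (<⇒≤ a<b) bm | cwDist-forward m a c (<⇒≤ a<c) cm = inj₁ (a<b , ∸-cancel-< {z = a} h)
... | tri< a<b _ _ | tri> _ _ c<a = inj₂ (inj₂ (c<a , a<b))
... | tri> _ _ b<a | tri< a<c _ _ rewrite cwDist-backward m a b b<a am | cwDist-forward m a c (<⇒≤ a<c) cm =
  ⊥-elim (<⇒≱ h (∸-monoˡ-≤ a (≤-trans cm (≤-trans (n≤1+n m) (m≤n+m (suc m) b)))))
... | tri> _ _ b<a | tri> _ _ c<a rewrite cwDist-backward m a b b<a am | cwDist-backward m a c c<a am = inj₂ (inj₁ (+-cancelʳ-< _ _ _ (∸-cancel-< {z = a} h) , c<a))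

cyclic⇒cwDist< : ∀ m a b c → a ≤ m → b ≤ m → c ≤ m → a ≢ b → a ≢ c →
  Cyclic a b c → cwDist m a b < cwDist m a c
cyclic⇒cwDist< m a b c am bm cm ab ac h with <-cmp a b | <-cmp a c
... | tri≈ _ e _ | _ = ⊥-elim (ab e)
... | _ | tri≈ _ e _ = ⊥-elim (ac e)
... | tri< a<b _ _ | tri< a<c _ _ rewrite cwDist-forward m a b (<⇒≤ a<b) bm | cwDist-forward m a c (<⇒≤ a<c) cm = ∸-monoˡ-< (cyclic-above a<b a<c h) (<⇒≤ a<b)
... | tri< a<b _ _ | tri> _ _ c<a rewrite cwDist-forward m a b (<⇒≤ a<b) bm | cwDist-backward m a c c<a am =
  ∸-monoˡ-< (≤-trans (s≤s bm) (m≤n+m (suc m) c)) (<⇒≤ a<b)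
... | tri> _ _ b<a | tri< a<c _ _ with h
... | inj₁ (x , _) = ⊥-elim (<-asym x b<a)
... | inj₂ (inj₁ (_ , x)) = ⊥-elim (<-asym x a<c)
... | inj₂ (inj₂ (x , _)) = ⊥-elim (<-asym x a<c)
cyclic⇒cwDist< m a b c am bm cm ab ac h | tri> _ _ b<a | tri> _ _ c<a rewrite cwDist-backward m a b b<a am | cwDist-backward m a c c<a am with h
... | inj₁ (x , _) = ⊥-elim (<-asym x b<a)
... | inj₂ (inj₂ (_ , x)) = ⊥-elim (<-asym x b<a)
... | inj₂ (inj₁ (b<c , _)) = ∸-monoˡ-< (+-monoˡ-< (suc m) b<c) (≤-trans am (≤-trans (n≤1+n m) (m≤n+m (suc m) b)))

cwDist< : ∀ m a s → cwDist m a s < suc m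
cwDist< m a s = m%n<n (s + suc m ∸ a) (suc m)

cwDist-self : ∀ m a → a ≤ m → cwDist m a a ≡ 0
cwDist-self m a am = trans (cwDist-forward m a a ≤-refl am) (n∸n≡0 a)

-- adding back the start recovers the end slot, so cwDist m a is injective
cwDist-retract : ∀ m a s → a ≤ m → s ≤ m → (cwDist m a s + a) % suc m ≡ s
cwDist-retract m a s am sm = begin
  ((x % M) + a) % M            ≡⟨ %-distribˡ-+ (x % M) a M ⟩
  ((x % M % M) + a % M) % M    ≡⟨ cong (λ z → (z + a % M) % M) (m%n%n≡m%n x M) ⟩
  ((x % M) + a % M) % M        ≡⟨ sym (%-distribˡ-+ x a M) ⟩
  (x + a) % M                  ≡⟨ cong (_% M) (m∸n+n≡m (≤-trans am (≤-trans (n≤1+n m) (m≤n+m M s)))) ⟩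
  (s + M) % M                  ≡⟨ [m+n]%n≡m%n s M ⟩
  s % M                        ≡⟨ m<n⇒m%n≡m (s≤s sm) ⟩
  s ∎
  where
  open ≡-Reasoning
  M = suc m
  x = s + M ∸ a

cwDist-injective : ∀ m a s t → a ≤ m → s ≤ m → t ≤ m → cwDist m a s ≡ cwDist m a t → s ≡ t
cwDist-injective m a s t am sm tm e =
  trans (sym (cwDist-retract m a s am sm)) (trans (cong (λ d → (d + a) % suc m) e) (cwDist-retract m a t am tm))

cwDist-complement : ∀ m a b → a ≤ m → b ≤ m → a ≢ b → cwDist m a b + cwDist m b a ≡ suc m
cwDist-complement m a b am bm ab with <-cmp a b
... | tri≈ _ e _ = ⊥-elim (ab e)
... | tri< x _ _ rewrite cwDist-forward m a b (<⇒≤ x) bm | cwDist-backward m b a x bm = +-cancelʳ-≡ b _ _ (begin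
      (b ∸ a) + (a + suc m ∸ b) + b ≡⟨ +-assoc (b ∸ a) _ b ⟩
      (b ∸ a) + ((a + suc m ∸ b) + b) ≡⟨ cong ((b ∸ a) +_) (m∸n+n≡m (≤-trans bm (≤-trans (n≤1+n m) (m≤n+m (suc m) a)))) ⟩
      (b ∸ a) + (a + suc m) ≡⟨ sym (+-assoc (b ∸ a) a (suc m)) ⟩
      (b ∸ a) + a + suc m ≡⟨ cong (_+ suc m) (m∸n+n≡m (<⇒≤ x)) ⟩
      b + suc m ≡⟨ +-comm b (suc m) ⟩
      suc m + b ∎)
  where open ≡-Reasoning
... | tri> _ _ x rewrite cwDist-backward m a b x am | cwDist-forward m b a (<⇒≤ x) am = +-cancelʳ-≡ a _ _ (begin
      (b + suc m ∸ a) + (a ∸ b) + a ≡⟨ cong (_+ a) (+-comm (b + suc m ∸ a) (a ∸ b)) ⟩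
      (a ∸ b) + (b + suc m ∸ a) + a ≡⟨ +-assoc (a ∸ b) _ a ⟩
      (a ∸ b) + ((b + suc m ∸ a) + a) ≡⟨ cong ((a ∸ b) +_) (m∸n+n≡m (≤-trans am (≤-trans (n≤1+n m) (m≤n+m (suc m) b)))) ⟩
      (a ∸ b) + (b + suc m) ≡⟨ sym (+-assoc (a ∸ b) b (suc m)) ⟩
      (a ∸ b) + b + suc m ≡⟨ cong (_+ suc m) (m∸n+n≡m (<⇒≤ x)) ⟩
      a + suc m ≡⟨ +-comm a (suc m) ⟩
      suc m + a ∎)
  where open ≡-Reasoning

cwDist-split : ∀ m a b c → a ≤ m → b ≤ m → c ≤ m → Cyclic a b c → cwDist m a c ≡ cwDist m a b + cwDist m b c
cwDist-split m a b c am bm cm (inj₁ (ab , bc))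
  rewrite cwDist-forward m a c (<⇒≤ (<-trans ab bc)) cm | cwDist-forward m a b (<⇒≤ ab) bm | cwDist-forward m b c (<⇒≤ bc) cm =
  +-cancelʳ-≡ a _ _ (begin
    (c ∸ a) + a ≡⟨ m∸n+n≡m (<⇒≤ (<-trans ab bc)) ⟩
    c ≡⟨ sym (m∸n+n≡m (<⇒≤ bc)) ⟩
    (c ∸ b) + b ≡⟨ cong ((c ∸ b) +_) (sym (m∸n+n≡m (<⇒≤ ab))) ⟩
    (c ∸ b) + ((b ∸ a) + a) ≡⟨ solve 3 (λ x y z → x :+ (y :+ z) := (y :+ x) :+ z) refl (c ∸ b) (b ∸ a) a ⟩
    (b ∸ a) + (c ∸ b) + a ∎)
  where open ≡-Reasoning
cwDist-split m a b c am bm cm (inj₂ (inj₁ (bc , ca)))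
  rewrite cwDist-backward m a c ca am | cwDist-backward m a b (<-trans bc ca) am | cwDist-forward m b c (<⇒≤ bc) cm =
  +-cancelʳ-≡ a _ _ (begin
    (c + suc m ∸ a) + a ≡⟨ m∸n+n≡m (≤-trans am (≤-trans (n≤1+n m) (m≤n+m (suc m) c))) ⟩
    c + suc m ≡⟨ cong (_+ suc m) (sym (m∸n+n≡m (<⇒≤ bc))) ⟩
    (c ∸ b) + b + suc m ≡⟨ solve 3 (λ x y z → (x :+ y) :+ z := x :+ (y :+ z)) refl (c ∸ b) b (suc m) ⟩
    (c ∸ b) + (b + suc m) ≡⟨ cong ((c ∸ b) +_) (sym (m∸n+n≡m (≤-trans am (≤-trans (n≤1+n m) (m≤n+m (suc m) b))))) ⟩
    (c ∸ b) + ((b + suc m ∸ a) + a) ≡⟨ solve 3 (λ x y z → x :+ (y :+ z) := (y :+ x) :+ z) refl (c ∸ b) (b + suc m ∸ a) a ⟩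
    (b + suc m ∸ a) + (c ∸ b) + a ∎)
  where open ≡-Reasoning
cwDist-split m a b c am bm cm (inj₂ (inj₂ (ca , ab)))
  rewrite cwDist-backward m a c ca am | cwDist-forward m a b (<⇒≤ ab) bm | cwDist-backward m b c (<-trans ca ab) bm =
  +-cancelʳ-≡ a _ _ (begin
    (c + suc m ∸ a) + a ≡⟨ m∸n+n≡m (≤-trans am (≤-trans (n≤1+n m) (m≤n+m (suc m) c))) ⟩
    c + suc m ≡⟨ sym (m∸n+n≡m (≤-trans bm (≤-trans (n≤1+n m) (m≤n+m (suc m) c)))) ⟩
    (c + suc m ∸ b) + b ≡⟨ cong ((c + suc m ∸ b) +_) (sym (m∸n+n≡m (<⇒≤ ab))) ⟩
    (c + suc m ∸ b) + ((b ∸ a) + a) ≡⟨ solve 3 (λ x y z → x :+ (y :+ z) := (y :+ x) :+ z) refl (c + suc m ∸ b) (b ∸ a) a ⟩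
    (b ∸ a) + (c + suc m ∸ b) + a ∎)
  where open ≡-Reasoning


InjectiveOn : ℕ → (ℕ → ℕ) → Set
InjectiveOn m P = ∀ x y → x ≤ m → y ≤ m → P x ≡ P y → x ≡ y

Valid : ∀ m → Placement m → Set
Valid m π = (posOf π 0 ≡ 0) × InjectiveOn m (posOf π)

at-bound : ∀ {m n} (v : Vec (Fin (suc m)) n) x → at (V.map toℕ v) x ≤ m
at-bound [] x = z≤n
at-bound (f ∷ v) zero = ≤-pred (toℕ<n f)
at-bound (f ∷ v) (suc x) = at-bound v x

posOf≤ : ∀ {m} (π : Placement m) x → posOf π x ≤ m
posOf≤ π x = at-bound π x

isCyclicOrder-sound : ∀ m (π : Placement m) → isCyclicOrder m π ≡ true → Valid m π
isCyclicOrder-sound m π h = ≡ᵇ-sound (∧-elimˡ h) , inj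
  where
  inj : InjectiveOn m (posOf π)
  inj x y xm ym e with allB-range0-sound m (∧-elimʳ {posOf π 0 ≡ᵇ 0} h) x xm
  ... | hx with allB-range0-sound m hx y ym
  ... | hxy with x ≡ᵇ y in exy
  ... | true = ≡ᵇ-sound exy
  ... | false = ⊥-elim (≡ᵇfalse⇒≢ (not-true⇒false hxy) e)

isCyclicOrder-complete : ∀ m (π : Placement m) → Valid m π → isCyclicOrder m π ≡ true
isCyclicOrder-complete m π (p0 , inj) with isCyclicOrder m π in e
... | true = refl
... | false with (posOf π 0 ≡ᵇ 0) in e0
... | false = ⊥-elim (≡ᵇfalse⇒≢ e0 p0)
... | true with allB-range0-false-witness m e
... | (x , xm , ex) with allB-range0-false-witness m ex
... | (y , ym , ey) with x ≡ᵇ y in exy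
... | true = ⊥-elim (true≢false ey)
... | false = ⊥-elim (≡ᵇfalse⇒≢ exy (inj x y xm ym (≡ᵇ-sound (not-false⇒true ey))))

isCyclicOrder-false : ∀ {N} (π : Placement N) → ¬ Valid N π → isCyclicOrder N π ≡ false
isCyclicOrder-false {N} π n with isCyclicOrder N π in e
... | true = ⊥-elim (n (isCyclicOrder-sound N π e))
... | false = refl

countB-range0 : ∀ m (p : ℕ → Bool) → countB (range 0 m) p ≡ ∑ (interval 0 (suc m)) (λ h → ind (p h))
countB-range0 m p = trans (countB≡∑ (range 0 m) p) (cong (λ xs → ∑ xs (λ h → ind (p h))) (range0≡interval m))

≡ᵇ-injective : ∀ {m} (f : ℕ → ℕ) → InjectiveOn m f → ∀ {x y} → x ≤ m → y ≤ m → (f x ≡ᵇ f y) ≡ (x ≡ᵇ y)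
≡ᵇ-injective f inj xm ym = Bool-ext (λ e → ≡ᵇ-complete (inj _ _ xm ym (≡ᵇ-sound e)))
                                    (λ e → ≡ᵇ-complete (cong f (≡ᵇ-sound e)))

distinct3-injective : ∀ {m} (f : ℕ → ℕ) → InjectiveOn m f → ∀ {x y z} → x ≤ m → y ≤ m → z ≤ m →
  distinct3 (f x) (f y) (f z) ≡ distinct3 x y z
distinct3-injective f inj xm ym zm
  rewrite ≡ᵇ-injective f inj xm ym | ≡ᵇ-injective f inj ym zm | ≡ᵇ-injective f inj xm zm = refl

strictly-below : ∀ D e → 1 ≤ D → 1 ≤ e → (distinct3 0 e D ∧ (e <ᵇ D)) ≡ (e <ᵇ D)
strictly-below (suc D) (suc e) _ _ rewrite ∧-identityʳ (not (e ≡ᵇ D)) with e ≡ᵇ D in q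
... | false = refl
... | true rewrite ≡ᵇ-sound {e} q = sym (n<ᵇn≡false D)

module ValidPlacement {m : ℕ} (π : Placement m) (V : Valid m π) where
  P : ℕ → ℕ
  P = posOf π

  inj : InjectiveOn m P
  inj = proj₂ V

  P≤ : ∀ x → P x ≤ m
  P≤ = posOf≤ π

  Pne : ∀ {x y} → x ≤ m → y ≤ m → x ≢ y → P x ≢ P y
  Pne xm ym ne e = ne (inj _ _ xm ym e)

  InP : ℕ → ℕ → ℕ → Set
  InP x y z = x ≢ y × y ≢ z × x ≢ z × Cyclic (P x) (P y) (P z)

  inπ→ : ∀ {x y z} → x ≤ m → y ≤ m → z ≤ m → inπ π x y z ≡ true → InP x y z
  inπ→ {x} {y} {z} xm ym zm h = xy , yz , xz ,
      cwDist<⇒cyclic m (P x) (P y) (P z) (P≤ x) (P≤ y) (P≤ z) (Pne xm ym xy) (Pne xm zm xz) (<ᵇ-sound (∧-elimʳ {distinct3 x y z} h))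
    where
    d3 = ∧-elimˡ {distinct3 x y z} h
    xy : x ≢ y
    xy = ≡ᵇfalse⇒≢ (not-true⇒false (∧-elimˡ {not (x ≡ᵇ y)} d3))
    yz : y ≢ z
    yz = ≡ᵇfalse⇒≢ (not-true⇒false (∧-elimˡ {not (y ≡ᵇ z)} (∧-elimʳ {not (x ≡ᵇ y)} d3)))
    xz : x ≢ z
    xz = ≡ᵇfalse⇒≢ (not-true⇒false (∧-elimʳ {not (y ≡ᵇ z)} (∧-elimʳ {not (x ≡ᵇ y)} d3)))

  →inπ : ∀ {x y z} → x ≤ m → y ≤ m → z ≤ m → InP x y z → inπ π x y z ≡ true
  →inπ {x} {y} {z} xm ym zm (xy , yz , xz , c) =
    ∧-intro (∧-intro (false⇒not-true (≢⇒≡ᵇfalse xy)) (∧-intro (false⇒not-true (≢⇒≡ᵇfalse yz)) (false⇒not-true (≢⇒≡ᵇfalse xz))))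
        (<ᵇ-complete (cyclic⇒cwDist< m (P x) (P y) (P z) (P≤ x) (P≤ y) (P≤ z) (Pne xm ym xy) (Pne xm zm xz) c))

  -- Counting the h between i and j: relabel h by its slot s = P h, then by
  -- its distance e = cwDist (P i) s; the h between i and j become the
  -- distances 1 ≤ e < D, where D is the distance from i to j.
  L≡cwDist : ∀ i j → i ≤ m → j ≤ m → i ≢ j → Lπ π i j ≡ cwDist m (P i) (P j)
  L≡cwDist i j im jm ij = begin
    suc (countB (range 0 m) (λ h → inπ π i h j))
      ≡⟨ cong suc (countB-range0 m (λ h → inπ π i h j)) ⟩
    suc (∑ R (λ h → ind (inπ π i h j)))
      ≡⟨ cong suc (∑-interval-cong 0 (suc m) (λ h _ hm →
           cong (λ b → ind (b ∧ (cwDist m pa (P h) <ᵇ D))) (sym (distinct3-injective P inj im (≤-pred hm) jm)))) ⟩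
    suc (∑ R (λ h → F (P h)))
      ≡⟨ cong suc (∑-permute (suc m) P F (λ x _ → s≤s (P≤ x)) (λ x y xm ym → inj x y (≤-pred xm) (≤-pred ym))) ⟩
    suc (∑ R F)
      ≡⟨ cong suc (∑-interval-cong 0 (suc m) (λ s _ sm → cong (λ b → ind (b ∧ (cwDist m pa s <ᵇ D))) (by-distance (≤-pred sm)))) ⟩
    suc (∑ R (λ s → G (cwDist m pa s)))
      ≡⟨ cong suc (∑-permute (suc m) (cwDist m pa) G (λ x _ → cwDist< m pa x) (λ x y xm ym → dist-inj x y (≤-pred xm) (≤-pred ym))) ⟩
    suc (∑ R G)
      ≡⟨ cong suc (∑-interval-cong 1 m (λ e 1e _ → cong ind (strictly-below D e D≥1 1e))) ⟩
    suc (∑ (interval 1 m) (λ e → ind (e <ᵇ D)))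
      ≡⟨ cong suc (count-below 1 m D D≥1 (≤-trans (≤-pred (cwDist< m pa pb)) (n≤1+n m))) ⟩
    suc (D ∸ 1)
      ≡⟨ m+[n∸m]≡n D≥1 ⟩
    D ∎
    where
    open ≡-Reasoning
    R = interval 0 (suc m)
    pa = P i
    pb = P j
    D = cwDist m pa pb
    F : ℕ → ℕ
    F s = ind (distinct3 pa s pb ∧ (cwDist m pa s <ᵇ D))
    G : ℕ → ℕ
    G e = ind (distinct3 0 e D ∧ (e <ᵇ D))
    dist-inj : InjectiveOn m (cwDist m pa)
    dist-inj x y = cwDist-injective m pa x y (P≤ i)
    D≥1 : 1 ≤ D
    D≥1 with D in eD
    ... | zero = ⊥-elim (Pne im jm ij (dist-inj pa pb (P≤ i) (P≤ j) (trans (cwDist-self m pa (P≤ i)) (sym eD))))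
    ... | suc _ = s≤s z≤n
    by-distance : ∀ {s} → s ≤ m → distinct3 pa s pb ≡ distinct3 0 (cwDist m pa s) D
    by-distance {s} sm = trans (sym (distinct3-injective (cwDist m pa) dist-inj (P≤ i) sm (P≤ j)))
                           (cong (λ z → distinct3 z (cwDist m pa s) D) (cwDist-self m pa (P≤ i)))

  L-split : ∀ {a b c} → a ≤ m → b ≤ m → c ≤ m → inπ π a b c ≡ true → Lπ π a c ≡ Lπ π a b + Lπ π b c
  L-split {a} {b} {c} am bm cm h with inπ→ am bm cm h
  ... | (ab , bc , ac , cy) = trans (L≡cwDist a c am cm ac) (trans (cwDist-split m (P a) (P b) (P c) (P≤ a) (P≤ b) (P≤ c) cy)
        (sym (cong₂ _+_ (L≡cwDist a b am bm ab) (L≡cwDist b c bm cm bc))))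

  L-complement : ∀ {a b} → a ≤ m → b ≤ m → a ≢ b → Lπ π a b + Lπ π b a ≡ suc m
  L-complement {a} {b} am bm ab = trans (cong₂ _+_ (L≡cwDist a b am bm ab) (L≡cwDist b a bm am (λ e → ab (sym e))))
    (cwDist-complement m (P a) (P b) (P≤ a) (P≤ b) (Pne am bm ab))

  Between : ℕ → ℕ → ℕ → Set
  Between x y z = inπ π x y z ≡ true

  between-rotate : ∀ {a b c} → a ≤ m → b ≤ m → c ≤ m → Between a b c → Between b c a
  between-rotate am bm cm h with inπ→ am bm cm h
  ... | (ab , bc , ac , cy) = →inπ bm cm am (bc , (λ e → ac (sym e)) , (λ e → ab (sym e)) , cyclic-rotate cy)

  between-asym : ∀ {a b c} → a ≤ m → b ≤ m → c ≤ m → Between a b c → Between a c b → ⊥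
  between-asym am bm cm h1 h2 = cyclic-asym (proj₂ (proj₂ (proj₂ (inπ→ am bm cm h1)))) (proj₂ (proj₂ (proj₂ (inπ→ am cm bm h2))))

  between-total : ∀ {a b c} → a ≤ m → b ≤ m → c ≤ m → a ≢ b → b ≢ c → a ≢ c → Between a b c ⊎ Between a c b
  between-total {a} {b} {c} am bm cm ab bc ac with cyclic-total (P a) (P b) (P c) (Pne am bm ab) (Pne bm cm bc) (Pne am cm ac)
  ... | inj₁ cy = inj₁ (→inπ am bm cm (ab , bc , ac , cy))
  ... | inj₂ cy = inj₂ (→inπ am cm bm (ac , (λ e → bc (sym e)) , ab , cy))

  between-trans₁ : ∀ {a b c d} → a ≤ m → b ≤ m → c ≤ m → d ≤ m → Between a b c → Between a c d → a ≢ d → b ≢ d → Between a b d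
  between-trans₁ am bm cm dm h1 h2 ad bd with inπ→ am bm cm h1 | inπ→ am cm dm h2
  ... | (ab , _ , _ , c1) | (_ , _ , _ , c2) = →inπ am bm dm (ab , bd , ad , cyclic-trans₁ c1 c2)

  between-trans₂ : ∀ {a b c d} → a ≤ m → b ≤ m → c ≤ m → d ≤ m → Between a b c → Between a c d → b ≢ d → Between b c d
  between-trans₂ am bm cm dm h1 h2 bd with inπ→ am bm cm h1 | inπ→ am cm dm h2
  ... | (_ , bc , _ , c1) | (_ , cd , _ , c2) = →inπ bm cm dm (bc , cd , bd , cyclic-trans₂ c1 c2)


r+≢ : ∀ r {i j} → i ≢ j → r + i ≢ r + j
r+≢ r ne e = ne (+-cancelˡ-≡ r _ _ e)

r+1 : ∀ r a → r + a + 1 ≡ r + suc a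
r+1 r a = trans (+-assoc r a 1) (cong (r +_) (+-comm a 1))

r≢ : ∀ r j → r ≢ r + suc j
r≢ r j e = <-irrefl e (m<m+n r (s≤s z≤n))

module Chain {m : ℕ} (π : Placement m) (V : Valid m π) (r k : ℕ) (rk : r + k ≤ m)
  (ch : ∀ a → 1 ≤ a → a < k → inπ π r (r + a) (r + a + 1) ≡ true) where
  open ValidPlacement π V

  bnd0 : r ≤ m
  bnd0 = ≤-trans (m≤m+n r k) rk

  bnd : ∀ i → i ≤ k → r + i ≤ m
  bnd i ik = ≤-trans (+-monoʳ-≤ r ik) rk

  chain-triple : ∀ i j → 1 ≤ i → i < j → j ≤ k → Between r (r + i) (r + j)
  chain-triple i (suc j') 1i ij jk with m≤n⇒m<n∨m≡n (≤-pred ij)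
  ... | inj₂ refl = subst (Between r (r + i)) (r+1 r i) (ch i 1i jk)
  ... | inj₁ ij' = between-trans₁ bnd0 (bnd i (≤-trans (<⇒≤ ij) jk)) (bnd j' (<⇒≤ jk)) (bnd (suc j') jk)
        (chain-triple i j' 1i ij' (<⇒≤ jk))
        (subst (Between r (r + j')) (r+1 r j') (ch j' (≤-trans 1i (<⇒≤ ij')) jk))
        (r≢ r j')
        (r+≢ r (λ e → <-irrefl e (<-trans ij' (n<1+n j'))))

  chain-triple-second : ∀ i j → 2 ≤ i → i < j → j ≤ k → Between (r + 1) (r + i) (r + j)
  chain-triple-second i j 2i ij jk = between-trans₂ bnd0 (bnd 1 (≤-trans (s≤s z≤n) (≤-trans 2i (≤-trans (<⇒≤ ij) jk)))) (bnd i (≤-trans (<⇒≤ ij) jk)) (bnd j jk)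
    (chain-triple 1 i ≤-refl 2i (≤-trans (<⇒≤ ij) jk)) (chain-triple i j (≤-trans (s≤s z≤n) 2i) ij jk)
    (r+≢ r (λ e → <-irrefl e (≤-trans (s≤s (s≤s z≤n)) (≤-trans 2i (<⇒≤ ij)))))


-- Inserting the top element.  insertTop p v puts the new element N into
-- slot p of the circle with N+1 slots and moves every element of v to the
-- image of its old slot under punchIn p.  Every valid placement of [N]
-- arises in this way from a unique valid v and a unique slot p ≥ 1.

insertTop : ∀ {N} → Fin (suc N) → Vec (Fin N) N → Placement N
insertTop p v = V.map (F.punchIn p) v V.∷ʳ p

at-snoc-lt : ∀ {M n} (v : Vec (Fin M) n) q x → x < n → at (V.map toℕ (v V.∷ʳ q)) x ≡ at (V.map toℕ v) x
at-snoc-lt (f ∷ v) q zero _ = refl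
at-snoc-lt (f ∷ v) q (suc x) (s≤s xn) = at-snoc-lt v q x xn

at-snoc-eq : ∀ {M n} (v : Vec (Fin M) n) q → at (V.map toℕ (v V.∷ʳ q)) n ≡ toℕ q
at-snoc-eq [] q = refl
at-snoc-eq (f ∷ v) q = at-snoc-eq v q

at-map-punchIn : ∀ {M n} (p : Fin (suc M)) (v : Vec (Fin M) n) x → x < n →
  at (V.map toℕ (V.map (F.punchIn p) v)) x ≡ punchInℕ (toℕ p) (at (V.map toℕ v) x)
at-map-punchIn p (f ∷ v) zero _ = toℕ-punchIn p f
at-map-punchIn p (f ∷ v) (suc x) (s≤s xn) = at-map-punchIn p v x xn

∈⇒at : ∀ {M n} {q : Fin M} (v : Vec (Fin M) n) → q VM.∈ v → Σ ℕ (λ x → x < n × at (V.map toℕ v) x ≡ toℕ q)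
∈⇒at (f ∷ v) (here refl) = 0 , s≤s z≤n , refl
∈⇒at (f ∷ v) (there m) with ∈⇒at v m
... | (x , xn , e) = suc x , s≤s xn , e

module Insertion {m' : ℕ} (p : Fin (suc (suc m'))) (v : Placement m') where
  N = suc m'
  π : Placement N
  π = insertTop p v
  P' = posOf v
  P = posOf π

  P-lt : ∀ x → x < N → P x ≡ punchInℕ (toℕ p) (P' x)
  P-lt x xN = trans (at-snoc-lt (V.map (F.punchIn p) v) p x xN) (at-map-punchIn p v x xN)
  P-N : P N ≡ toℕ p
  P-N = at-snoc-eq (V.map (F.punchIn p) v) p

  valid→ins : Valid N π → Valid m' v × 0 < toℕ p
  valid→ins (p0 , inj) = (proj₁ z0 , inj') , proj₂ z0
    where
    z0 = punchInℕ≡0 (trans (sym (P-lt 0 (s≤s z≤n))) p0)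
    inj' : InjectiveOn m' P'
    inj' x y xm ym e = inj x y (≤-trans xm (n≤1+n m')) (≤-trans ym (n≤1+n m'))
      (trans (P-lt x (s≤s xm)) (trans (cong (punchInℕ (toℕ p)) e) (sym (P-lt y (s≤s ym)))))

  ins→valid : Valid m' v → 0 < toℕ p → Valid N π
  ins→valid (p0 , inj) pp = trans (P-lt 0 (s≤s z≤n)) (trans (cong (punchInℕ (toℕ p)) p0) (punchInℕ-below pp)) , inj'
    where
    inj' : InjectiveOn N P
    inj' x y xm ym e with m≤n⇒m<n∨m≡n xm | m≤n⇒m<n∨m≡n ym
    ... | inj₁ xN | inj₁ yN = inj x y (≤-pred xN) (≤-pred yN) (punchInℕ-injective (toℕ p) (trans (sym (P-lt x xN)) (trans e (P-lt y yN))))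
    ... | inj₁ xN | inj₂ refl = ⊥-elim (punchInℕ-≢ (toℕ p) (P' x) (trans (sym (P-lt x xN)) (trans e P-N)))
    ... | inj₂ refl | inj₁ yN = ⊥-elim (punchInℕ-≢ (toℕ p) (P' y) (trans (sym (P-lt y yN)) (trans (sym e) P-N)))
    ... | inj₂ refl | inj₂ refl = refl

snoc-member-invalid : ∀ {N} (p : Fin (suc N)) (w : Vec (Fin (suc N)) N) → p VM.∈ w → ¬ Valid N (w V.∷ʳ p)
snoc-member-invalid {N} p w mem (_ , inj) with ∈⇒at w mem
... | (x , xN , e) = <-irrefl (inj x N (<⇒≤ xN) ≤-refl (trans (at-snoc-lt w p x xN) (trans e (sym (at-snoc-eq w p))))) xN

-- Inserting N leaves the cyclic order among the old elements unchanged, so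
-- an L-value between old elements grows by one exactly when N lies between.
module ValidInsertion {m' : ℕ} (p : Fin (suc (suc m'))) (v : Placement m') (Vv : Valid m' v) (pp : 0 < toℕ p) where
  open Insertion p v public
  Vπ : Valid N π
  Vπ = ins→valid Vv pp
  module A = ValidPlacement π Vπ
  module B = ValidPlacement v Vv

  inπ-insertTop : ∀ {x y z} → x < N → y < N → z < N → inπ π x y z ≡ inπ v x y z
  inπ-insertTop {x} {y} {z} xN yN zN = Bool-ext f g
    where
    f : _ → _
    f h with A.inπ→ (<⇒≤ xN) (<⇒≤ yN) (<⇒≤ zN) h
    ... | (xy , yz , xz , c) rewrite P-lt x xN | P-lt y yN | P-lt z zN = B.→inπ (≤-pred xN) (≤-pred yN) (≤-pred zN) (xy , yz , xz , punchInℕ-reflects-cyclic (toℕ p) c)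
    g : _ → _
    g h with B.inπ→ (≤-pred xN) (≤-pred yN) (≤-pred zN) h
    ... | (xy , yz , xz , c) = A.→inπ (<⇒≤ xN) (<⇒≤ yN) (<⇒≤ zN) (xy , yz , xz , subst₂ (λ a b → Cyclic a b (P z)) (sym (P-lt x xN)) (sym (P-lt y yN)) (subst (Cyclic _ _) (sym (P-lt z zN)) (punchInℕ-preserves-cyclic (toℕ p) c)))

  L-insertTop : ∀ {x y} → x < N → y < N → Lπ π x y ≡ Lπ v x y + ind (inπ π x N y)
  L-insertTop {x} {y} xN yN = cong suc (begin
    countB (range 0 N) (λ h → inπ π x h y)
      ≡⟨ countB-range0 N (λ h → inπ π x h y) ⟩
    ∑ (interval 0 (suc N)) (λ h → ind (inπ π x h y))
      ≡⟨ ∑-interval-snoc 0 N (λ h → ind (inπ π x h y)) ⟩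
    ∑ (interval 0 N) (λ h → ind (inπ π x h y)) + ind (inπ π x N y)
      ≡⟨ cong (_+ ind (inπ π x N y)) (∑-interval-cong 0 N (λ h _ hN → cong ind (inπ-insertTop xN hN yN))) ⟩
    ∑ (interval 0 N) (λ h → ind (inπ v x h y)) + ind (inπ π x N y)
      ≡⟨ cong (_+ ind (inπ π x N y)) (sym (countB-range0 m' (λ h → inπ v x h y))) ⟩
    countB (range 0 m') (λ h → inπ v x h y) + ind (inπ π x N y) ∎)
    where open ≡-Reasoning

isCyclicOrder-insertTop : ∀ {m'} (p : Fin (suc (suc m'))) (u : Placement m') →
  isCyclicOrder (suc m') (insertTop p u) ≡ isCyclicOrder m' u ∧ (0 <ᵇ toℕ p)
isCyclicOrder-insertTop {m'} p u = Bool-ext f g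
  where
  open Insertion p u
  f : _ → _
  f h with valid→ins (isCyclicOrder-sound N π h)
  ... | (vu , pp) = ∧-intro (isCyclicOrder-complete m' u vu) (<ᵇ-complete pp)
  g : _ → _
  g h = isCyclicOrder-complete N π (ins→valid (isCyclicOrder-sound m' u (∧-elimˡ {isCyclicOrder m' u} h)) (<ᵇ-sound (∧-elimʳ {isCyclicOrder m' u} h)))

-- Counting cyclic orders of [m'+1] with a property Q by the position of the
-- top element: enumerate all vectors, split off the last entry p (the slot
-- of the top element), discard the vectors in which p occurs twice, and
-- recognise the rest as insertTop p u.
count-by-insertion : ∀ m' (Q : Placement (suc m') → Bool) →
  length (L.filterᵇ Q (cyclicOrders (suc m'))) ≡
  ∑ (cyclicOrders m') (λ u → ∑ (allFin (suc (suc m'))) (λ p → ind (0 <ᵇ toℕ p) * ind (Q (insertTop p u))))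
count-by-insertion m' Q = begin
  length (L.filterᵇ Q (L.filterᵇ Vb (allVecs (suc N) (suc N))))
    ≡⟨ length-filter Q (L.filterᵇ Vb (allVecs (suc N) (suc N))) ⟩
  ∑ (L.filterᵇ Vb (allVecs (suc N) (suc N))) (λ π → ind (Q π))
    ≡⟨ ∑-filter Vb (allVecs (suc N) (suc N)) (λ π → ind (Q π)) ⟩
  ∑ (allVecs (suc N) (suc N)) H
    ≡⟨ ∑-allVecs-snoc (suc N) N H ⟩
  ∑ (allVecs (suc N) N) (λ w → ∑ (allFin (suc N)) (λ p → H (w V.∷ʳ p)))
    ≡⟨ ∑-swap (allVecs (suc N) N) (allFin (suc N)) (λ w p → H (w V.∷ʳ p)) ⟩
  ∑ (allFin (suc N)) (λ p → ∑ (allVecs (suc N) N) (λ w → H (w V.∷ʳ p)))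
    ≡⟨ ∑-cong (allFin (suc N)) (λ p → ∑-allVecs-punchIn N N p (λ w → H (w V.∷ʳ p)) (λ w mem → cong (λ z → ind z * ind (Q (w V.∷ʳ p))) (isCyclicOrder-false (w V.∷ʳ p) (snoc-member-invalid p w mem)))) ⟩
  ∑ (allFin (suc N)) (λ p → ∑ (allVecs N N) (λ u → H (insertTop p u)))
    ≡⟨ ∑-cong (allFin (suc N)) (λ p → ∑-cong (allVecs N N) (λ u → hIns p u)) ⟩
  ∑ (allFin (suc N)) (λ p → ∑ (allVecs N N) (λ u → ind (isCyclicOrder m' u) * K p u))
    ≡⟨ sym (∑-swap (allVecs N N) (allFin (suc N)) (λ u p → ind (isCyclicOrder m' u) * K p u)) ⟩
  ∑ (allVecs N N) (λ u → ∑ (allFin (suc N)) (λ p → ind (isCyclicOrder m' u) * K p u))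
    ≡⟨ ∑-cong (allVecs N N) (λ u → ∑-*ˡ (allFin (suc N)) (ind (isCyclicOrder m' u)) (λ p → K p u)) ⟩
  ∑ (allVecs N N) (λ u → ind (isCyclicOrder m' u) * ∑ (allFin (suc N)) (λ p → K p u))
    ≡⟨ sym (∑-filter (isCyclicOrder m') (allVecs N N) (λ u → ∑ (allFin (suc N)) (λ p → K p u))) ⟩
  ∑ (cyclicOrders m') (λ u → ∑ (allFin (suc N)) (λ p → K p u)) ∎
  where
  open ≡-Reasoning
  N = suc m'
  Vb = isCyclicOrder N
  H : Placement N → ℕ
  H π = ind (Vb π) * ind (Q π)
  K : Fin (suc N) → Placement m' → ℕ
  K p u = ind (0 <ᵇ toℕ p) * ind (Q (insertTop p u))
  hIns : ∀ p u → H (insertTop p u) ≡ ind (isCyclicOrder m' u) * K p u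
  hIns p u = trans (cong (λ z → ind z * ind (Q (insertTop p u))) (isCyclicOrder-insertTop p u))
    (trans (cong (_* ind (Q (insertTop p u))) (ind-∧ (isCyclicOrder m' u) (0 <ᵇ toℕ p)))
      (*-assoc (ind (isCyclicOrder m' u)) (ind (0 <ᵇ toℕ p)) (ind (Q (insertTop p u)))))


-- If
-- an old element sits in slot A of v and N is inserted in slot x ≥ 1, then
-- the clockwise distance from that element to N is slotDist N A x.

slotDist : ℕ → ℕ → ℕ → ℕ
slotDist N A x = cwDist N (punchInℕ x A) x

slotDist-after : ∀ {N A x} → A < x → x ≤ N → slotDist N A x ≡ x ∸ A
slotDist-after {N} {A} {x} Ax xN = trans (cong (λ z → cwDist N z x) (punchInℕ-below Ax)) (cwDist-forward N A x (<⇒≤ Ax) xN)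

slotDist-before : ∀ {N A x} → x ≤ A → A < N → slotDist N A x ≡ x + N ∸ A
slotDist-before {N} {A} {x} xA AN = trans (cong (λ z → cwDist N z x) (punchInℕ-above xA)) (trans (cwDist-backward N (suc A) x (s≤s xA) AN) (cong (_∸ suc A) (+-suc x N)))

slotDist-bounds : ∀ {N A x} → A < N → 1 ≤ x → x ≤ N → 1 ≤ slotDist N A x × slotDist N A x ≤ N
slotDist-bounds {N} {A} {x} AN 1x xN with <-cmp A x
... | tri< Ax _ _ rewrite slotDist-after {N} Ax xN = m<n⇒0<n∸m Ax , ≤-trans (m∸n≤m x A) xN
... | tri≈ _ refl _ rewrite slotDist-before {N} {A} {A} ≤-refl AN = subst (1 ≤_) (sym (m+n∸m≡n A N)) (≤-trans 1x (<⇒≤ AN)) , ≤-reflexive (m+n∸m≡n A N)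
... | tri> _ _ xA rewrite slotDist-before {N} (<⇒≤ xA) AN =
  ≤-trans 1x (≤-trans (≤-reflexive (sym (m+n∸n≡m x N))) (∸-monoʳ-≤ (x + N) (<⇒≤ AN))) ,
  ≤-trans (∸-monoʳ-≤ (x + N) (<⇒≤ xA)) (≤-reflexive (m+n∸m≡n x N))

slotDist-after-≤ : ∀ {N A x} → A < x → x ≤ N → slotDist N A x ≤ N ∸ A
slotDist-after-≤ {N} {A} {x} Ax xN rewrite slotDist-after {N} Ax xN = ∸-monoˡ-≤ A xN

slotDist-before-> : ∀ {N A y} → A < N → 1 ≤ y → y ≤ A → N ∸ A < slotDist N A y
slotDist-before-> {N} {A} {y} AN 1y yA rewrite slotDist-before {N} yA AN =
  ≤-trans (≤-reflexive (sym (+-∸-assoc 1 (<⇒≤ AN)))) (∸-monoˡ-≤ A (+-monoˡ-≤ N 1y))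

slotDist-injective : ∀ {N A x y} → A < N → 1 ≤ x → x ≤ N → 1 ≤ y → y ≤ N → slotDist N A x ≡ slotDist N A y → x ≡ y
slotDist-injective {N} {A} {x} {y} AN 1x xN 1y yN e with x ≤? A | y ≤? A
... | yes xA | yes yA = +-cancelʳ-≡ N x y (∸-cancelʳ-≡ (A≤+N x) (A≤+N y)
        (trans (sym (slotDist-before {N} xA AN)) (trans e (slotDist-before {N} yA AN))))
  where A≤+N : ∀ z → A ≤ z + N
        A≤+N z = ≤-trans (<⇒≤ AN) (m≤n+m N z)
... | no xA | no yA = ∸-cancelʳ-≡ (<⇒≤ (≰⇒> xA)) (<⇒≤ (≰⇒> yA))
        (trans (sym (slotDist-after {N} (≰⇒> xA) xN)) (trans e (slotDist-after {N} (≰⇒> yA) yN)))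
... | yes xA | no yA = ⊥-elim (<-irrefl (sym e) (≤-<-trans (slotDist-after-≤ {N} (≰⇒> yA) yN) (slotDist-before-> AN 1x xA)))
... | no xA | yes yA = ⊥-elim (<-irrefl e (≤-<-trans (slotDist-after-≤ {N} (≰⇒> xA) xN) (slotDist-before-> AN 1y yA)))

slotDist-hits-once : ∀ N A b → A < N → 1 ≤ b → b ≤ N → ∑ (interval 0 (suc N)) (λ x → ind (0 <ᵇ x) * ind (slotDist N A x ≡ᵇ b)) ≡ 1
slotDist-hits-once N A b AN 1b bN = begin
  ∑ (interval 1 N) (λ x → ind (0 <ᵇ x) * ind (slotDist N A x ≡ᵇ b))
    ≡⟨ ∑-interval-shift 0 N (λ x → ind (0 <ᵇ x) * ind (slotDist N A x ≡ᵇ b)) ⟩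
  ∑ (interval 0 N) (λ y → ind (slotDist N A (suc y) ≡ᵇ b) + 0)
    ≡⟨ ∑-interval-cong 0 N (λ y _ yN → trans (+-identityʳ _) (cong (λ z → ind (z ≡ᵇ b)) (sym (fs y yN)))) ⟩
  ∑ (interval 0 N) (λ y → g (f y))
    ≡⟨ ∑-permute N f g (λ y yN → fb y yN) (λ y z yN zN e → suc-injective (slotDist-injective AN (s≤s z≤n) yN (s≤s z≤n) zN (trans (sym (fs y yN)) (trans (cong suc e) (fs z zN))))) ⟩
  ∑ (interval 0 N) g
    ≡⟨ sym (∑-interval-shift 0 N (λ x → ind (x ≡ᵇ b))) ⟩
  ∑ (interval 1 N) (λ x → ind (x ≡ᵇ b))
    ≡⟨ ∑-interval-cong 1 N (λ x _ _ → sym (*-identityʳ _)) ⟩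
  ∑ (interval 1 N) (λ x → ind (x ≡ᵇ b) * 1)
    ≡⟨ ∑-interval-point 1 N b (λ _ → 1) 1b (s≤s bN) ⟩
  1 ∎
  where
  open ≡-Reasoning
  f : ℕ → ℕ
  f y = slotDist N A (suc y) ∸ 1
  g : ℕ → ℕ
  g y = ind (suc y ≡ᵇ b)
  fs : ∀ y → y < N → suc (f y) ≡ slotDist N A (suc y)
  fs y yN = m+[n∸m]≡n (proj₁ (slotDist-bounds AN (s≤s z≤n) yN))
  fb : ∀ y → y < N → f y < N
  fb y yN = ≤-trans (≤-reflexive (fs y yN)) (proj₂ (slotDist-bounds AN (s≤s z≤n) yN))


∸-by : ∀ {x y} k → x ≡ y + k → x ∸ k ≡ y
∸-by {x} {y} k e = trans (cong (_∸ k) e) (m+n∸n≡m y k)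

-- the indices occurring in Ǎ^{(N)} and Ǎ^{(m')}, with m' = r + k, N = m' + 1
module IndexArith (r k : ℕ) where
  N+j∸k : ∀ j → suc (r + k) + j ∸ k ≡ suc (r + j)
  N+j∸k j = ∸-by k (solve 3 (λ r k j → (con 1 :+ (r :+ k)) :+ j := (con 1 :+ (r :+ j)) :+ k) refl r k j)
  N+1+j∸k : ∀ j → suc (r + k) + 1 + j ∸ k ≡ suc (suc (r + j))
  N+1+j∸k j = ∸-by k (solve 3 (λ r k j → ((con 1 :+ (r :+ k)) :+ con 1) :+ j := (con 1 :+ (con 1 :+ (r :+ j))) :+ k) refl r k j)
  N+1∸k : suc (r + k) + 1 ∸ k ≡ suc (suc r)
  N+1∸k = ∸-by k (solve 2 (λ r k → (con 1 :+ (r :+ k)) :+ con 1 := (con 1 :+ (con 1 :+ r)) :+ k) refl r k)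
  m'+j∸k : ∀ j → r + k + j ∸ k ≡ r + j
  m'+j∸k j = ∸-by k (solve 3 (λ r k j → (r :+ k) :+ j := (r :+ j) :+ k) refl r k j)
  m'+1+j∸k : ∀ j → r + k + 1 + j ∸ k ≡ suc (r + j)
  m'+1+j∸k j = ∸-by k (solve 3 (λ r k j → ((r :+ k) :+ con 1) :+ j := (con 1 :+ (r :+ j)) :+ k) refl r k j)
  m'+1∸k : r + k + 1 ∸ k ≡ suc r
  m'+1∸k = ∸-by k (solve 2 (λ r k → (r :+ k) :+ con 1 := (con 1 :+ r) :+ k) refl r k)
  N∸k : suc (r + k) ∸ k ≡ suc r
  N∸k = ∸-by k (solve 2 (λ r k → con 1 :+ (r :+ k) := (con 1 :+ r) :+ k) refl r k)
  m'∸k : r + k ∸ k ≡ r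
  m'∸k = m+n∸n≡m r k

at-addLast-lt : ∀ {K} c (w : Vec ℕ (suc K)) x → x < K → at (addLast c w) x ≡ at w x
at-addLast-lt c (y ∷ z ∷ w) zero _ = refl
at-addLast-lt c (y ∷ z ∷ w) (suc x) (s≤s xK) = at-addLast-lt c (z ∷ w) x xK

at-addLast-eq : ∀ {K} c (w : Vec ℕ (suc K)) → at (addLast c w) K ≡ at w K + c
at-addLast-eq c (y ∷ []) = refl
at-addLast-eq c (y ∷ z ∷ w) = at-addLast-eq c (z ∷ w)

at-init : ∀ {K} (w : Vec ℕ (suc K)) x → x < K → at (V.init w) x ≡ at w x
at-init (y ∷ z ∷ w) zero _ = refl
at-init (y ∷ z ∷ w) (suc x) (s≤s xK) = at-init (z ∷ w) x xK

at-last : ∀ {K} (w : Vec ℕ (suc K)) → V.last w ≡ at w K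
at-last (y ∷ []) = refl
at-last (y ∷ z ∷ w) = at-last (z ∷ w)

All-at : ∀ {n} {v : Vec ℕ n} x → All (1 ≤_) v → x < n → 1 ≤ at v x
All-at zero (p ∷ _) _ = p
All-at (suc x) (_ ∷ ps) (s≤s xn) = All-at x ps xn

two-entry-sum : ∀ K r x (xs : Vec ℕ (suc K)) → V.sum (x ∷ xs) ≡ suc (r + suc (suc K)) + 1 → K ≡ 0 →
  at (x ∷ xs) K + at (x ∷ xs) (suc K) ≡ suc (suc (r + suc (suc K)))
two-entry-sum zero r x (y ∷ []) h refl = trans (cong (x +_) (sym (+-identityʳ y))) (trans h (+-comm _ 1))

-- The arithmetic relating the two descriptions of the last entry:
-- b ≤ e and ℓ + b = e + t + 1  iff  e = b + (ℓ - t - 1) and t ≤ ℓ - 1 (for t ≥ 1).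
last-entry→ : ∀ b e t ℓ → 1 ≤ t → b ≤ e → ℓ + b ≡ e + t + 1 → (e ≡ b + (ℓ ∸ t ∸ 1)) × (t < suc (ℓ ∸ 1))
last-entry→ b e t ℓ 1t be eq = trans (sym eb) (cong (b +_) (sym dq)) , s≤s tl
  where
  d = e ∸ b
  eb : b + d ≡ e
  eb = m+[n∸m]≡n be
  ℓq : ℓ ≡ d + (t + 1)
  ℓq = +-cancelʳ-≡ b ℓ (d + (t + 1)) (trans eq (trans (cong (λ z → z + t + 1) (sym eb)) (solve 3 (λ b d t → ((b :+ d) :+ t) :+ con 1 := (d :+ (t :+ con 1)) :+ b) refl b d t)))
  dq : ℓ ∸ t ∸ 1 ≡ d
  dq = trans (∸-+-assoc ℓ t 1) (trans (cong (_∸ (t + 1)) ℓq) (m+n∸n≡m d (t + 1)))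
  tl : t ≤ ℓ ∸ 1
  tl = ≤-trans (m≤n+m t d) (≤-reflexive (sym (trans (cong (_∸ 1) ℓq) (trans (cong (_∸ 1) (sym (+-assoc d t 1))) (m+n∸n≡m (d + t) 1)))))

last-entry← : ∀ b e t ℓ → 1 ≤ t → e ≡ b + (ℓ ∸ t ∸ 1) → t < suc (ℓ ∸ 1) → (b ≤ e) × (ℓ + b ≡ e + t + 1)
last-entry← b e t ℓ 1t eq tl = ≤-trans (m≤m+n b d) (≤-reflexive (sym eq)) , goal
  where
  d = ℓ ∸ t ∸ 1
  t1ℓ : t + 1 ≤ ℓ
  t1ℓ = ≤-trans (+-monoˡ-≤ 1 (≤-pred tl)) (≤-reflexive (m∸n+n≡m (≤-trans (≤-trans 1t (≤-pred tl)) (m∸n≤m ℓ 1))))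
  ℓq : ℓ ≡ d + (t + 1)
  ℓq = sym (trans (cong (_+ (t + 1)) (∸-+-assoc ℓ t 1)) (m∸n+n≡m t1ℓ))
  goal : ℓ + b ≡ e + t + 1
  goal = trans (cong (_+ b) ℓq) (trans (solve 3 (λ b d t → (d :+ (t :+ con 1)) :+ b := ((b :+ d) :+ t) :+ con 1) refl b d t) (cong (λ z → z + t + 1) (sym eq)))


-- Write k = K + 2, m' = r + k and N = m' + 1,
-- and fix i = iv = (i_1, …, i_k) and a valid placement v of [m'].  The
-- relevant data of v are
--   chains-v     : v ∈ Â_{k,m'};
--   e'           = L_v(r+k, r+1), the value that the last entry of i'(t) must take;
--   t0           = L_v(r+1, r+2), the value that the first entry t of i'(t) must take;
--   middle-L-ok  : the conditions L(r+1+j, r+2+j) = i_j for 1 ≤ j ≤ K, which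
--                  Ǎ^{(N)}_iv and every Ǎ^{(m')}_{i'(t)} share;
-- and b = i_{k-1}, ℓ = i_k.  For K = 0 the last two entries of iv are tied
-- by Σ iv = N + 1, which lastTwoSum records.

module Step (K r : ℕ) (iv : Vec ℕ (suc (suc K))) (v : Placement (r + suc (suc K))) (Vv : Valid (r + suc (suc K)) v) where
  k m' N b ℓ : ℕ
  k = suc (suc K)
  m' = r + k
  N = suc m'
  b = at iv K
  ℓ = at iv (suc K)
  open IndexArith r k
  module B = ValidPlacement v Vv
  chains-v : Bool
  chains-v = inAhat k v
  e' t0 : ℕ
  e' = Lπ v (r + k) (suc r)
  t0 = Lπ v (suc r) (suc (suc r))
  middle-L-ok : ∀ {M} → Placement M → Bool
  middle-L-ok ρ = allB (interval 1 K) (λ j → Lπ ρ (suc (r + j)) (suc (suc (r + j))) ≡ᵇ at iv (j ∸ 1))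
  lastTwoSum : ℕ → ℕ
  lastTwoSum zero = suc N
  lastTwoSum (suc _) = e' + t0 + 1

  -- the condition on v under which some slot p ≥ 1 puts insertTop p v into Ǎ^{(N)}_iv
  v-admits-slot : Bool
  v-admits-slot = chains-v ∧ (middle-L-ok v ∧ ((b <ᵇ suc e') ∧ (ℓ + b ≡ᵇ lastTwoSum K)))

  rk : r + k ≡ suc (r + suc K)
  rk = +-suc r (suc K)

  chains-of-v : chains-v ≡ true → ∀ a → 1 ≤ a → a < k → inπ v r (r + a) (r + a + 1) ≡ true
  chains-of-v av a 1a ak = allB-interval-sound 1 (suc K) (trans (sym (allB≡ _ (range1≡interval K))) hr) a 1a ak
    where
    hr : isConsecChain v k r ≡ true
    hr = allB-interval-sound 0 (suc r) (trans (sym (allB≡ _ (trans (range0≡interval (m' ∸ k)) (cong (λ z → interval 0 (suc z)) m'∸k)))) av) r z≤n ≤-refl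

  -- Fix a slot p ≥ 1 and π = insertTop p v.  C says that N lies between
  -- r+k and r+1 in π, and β = L_π(r+k, N) is the new L-value that Ǎ^{(N)}_iv
  -- prescribes to be b.
  module AtSlot (p : Fin (suc N)) (pp : 0 < toℕ p) where
    open ValidInsertion p v Vv pp hiding (N; module B; module A)
    module Newπ = ValidPlacement π Vπ

    C : Bool
    C = inπ π (r + k) N (suc r)
    β : ℕ
    β = Lπ π (r + k) N

    inAcheck-unfold : inAcheck N iv π ≡ inAhat k π ∧ ((middle-L-ok π ∧ (β ≡ᵇ b)) ∧ (Lπ π N (suc (suc r)) ≡ᵇ ℓ))
    inAcheck-unfold = cong (inAhat k π ∧_) (cong₂ _∧_ mid lst)
      where
      F : ℕ → Bool
      F j = Lπ π (N + j ∸ k) (N + 1 + j ∸ k) ≡ᵇ at iv (j ∸ 1)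
      mid : allB (range 1 (k ∸ 1)) F ≡ middle-L-ok π ∧ (β ≡ᵇ b)
      mid = trans (allB≡ F (range1≡interval K)) (trans (allB-last 1 K F) (cong₂ _∧_
        (allB-interval-cong 1 K (λ j _ _ → cong₂ (λ x y → Lπ π x y ≡ᵇ at iv (j ∸ 1)) (N+j∸k j) (N+1+j∸k j)))
        (cong₂ (λ x y → Lπ π x y ≡ᵇ b) (trans (N+j∸k (suc K)) (sym rk)) (trans (N+1+j∸k (suc K)) (cong suc (sym rk))))))
      lst : (Lπ π N (N + 1 ∸ k) ≡ᵇ at iv (k ∸ 1)) ≡ (Lπ π N (suc (suc r)) ≡ᵇ ℓ)
      lst = cong (λ x → Lπ π N x ≡ᵇ ℓ) N+1∸k

    -- the chains of π starting at 0..r only involve old elements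
    inAhat-split : inAhat k π ≡ chains-v ∧ isConsecChain π k (suc r)
    inAhat-split = trans (allB≡ _ (trans (range0≡interval (N ∸ k)) (cong (λ z → interval 0 (suc z)) N∸k)))
           (trans (allB-last 0 (suc r) (isConsecChain π k))
           (cong (_∧ isConsecChain π k (suc r))
             (trans (allB-interval-cong 0 (suc r) (λ i _ ir → same i (≤-pred ir)))
                    (sym (allB≡ _ (trans (range0≡interval (m' ∸ k)) (cong (λ z → interval 0 (suc z)) m'∸k)))))))
      where
      same : ∀ i → i ≤ r → isConsecChain π k i ≡ isConsecChain v k i
      same i ir = trans (allB≡ _ (range1≡interval K)) (trans (allB-interval-cong 1 (suc K) (λ a _ ak → inπ-insertTop (lt0 i a ir) (lt1 i a ir ak) (lt2 i a ir ak))) (sym (allB≡ _ (range1≡interval K))))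
        where
        bnd : ∀ i a → i ≤ r → a < 1 + suc K → i + a + 1 ≤ r + k
        bnd i a ir ak = ≤-trans (≤-reflexive (+-comm (i + a) 1)) (≤-trans (s≤s (+-mono-≤ ir (≤-pred ak))) (≤-reflexive (sym rk)))
        lt0 : ∀ i a → i ≤ r → i < N
        lt0 i a ir = s≤s (≤-trans ir (m≤m+n r k))
        lt1 : ∀ i a → i ≤ r → a < 1 + suc K → i + a < N
        lt1 i a ir ak = s≤s (≤-trans (≤-trans (m≤m+n (i + a) 1) (bnd i a ir ak)) ≤-refl)
        lt2 : ∀ i a → i ≤ r → a < 1 + suc K → i + a + 1 < N
        lt2 i a ir ak = s≤s (bnd i a ir ak)

    ltN : ∀ i → i ≤ k → r + i < N
    ltN i ik = s≤s (+-monoʳ-≤ r ik)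
    leN : ∀ i → i ≤ k → r + i ≤ N
    leN i ik = <⇒≤ (ltN i ik)
    ne : ∀ {x y} → x < y → x ≢ y
    ne = <⇒≢
    ne' : ∀ {x y} → y < x → x ≢ y
    ne' h e = <⇒≢ h (sym e)
    r1 : r + 1 ≡ suc r
    r1 = +-comm r 1
    sr≤N : suc r ≤ N
    sr≤N = s≤s (≤-trans (n≤1+n r) (≤-trans (≤-reflexive (sym r1)) (+-monoʳ-≤ r (s≤s z≤n))))
    sr<rk : suc r < r + k
    sr<rk = subst (λ z → z < r + k) r1 (+-monoʳ-< r (s≤s (s≤s z≤n)))

    between-insertTop : ∀ {x y z} → x < N → y < N → z < N → inπ v x y z ≡ true → inπ π x y z ≡ true
    between-insertTop xN yN zN h = trans (inπ-insertTop xN yN zN) h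

    module GivenChains (av : chains-v ≡ true) where
      module Ch = Chain v Vv r k ≤-refl (chains-of-v av)

      chain-triple-π : ∀ i j → 2 ≤ i → i < j → j ≤ k → inπ π (suc r) (r + i) (r + j) ≡ true
      chain-triple-π i j 2i ij jk = subst (λ z → inπ π z (r + i) (r + j) ≡ true) r1
        (between-insertTop (ltN 1 (≤-trans (s≤s z≤n) (≤-trans 2i (≤-trans (<⇒≤ ij) jk)))) (ltN i (≤-trans (<⇒≤ ij) jk)) (ltN j jk) (Ch.chain-triple-second i j 2i ij jk))

      newChain≡C : isConsecChain π k (suc r) ≡ C
      newChain≡C = trans (allB≡ G (range1≡interval K)) (trans (allB-last 1 K G) (trans (cong (_∧ G (1 + K)) first) lastG))
        where
        G : ℕ → Bool
        G a = inπ π (suc r) (suc r + a) (suc r + a + 1)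
        first : allB (interval 1 K) G ≡ true
        first = allB-interval-complete 1 K (λ a 1a aK → subst₂ (λ y z → inπ π (suc r) y z ≡ true) (+-suc r a) (trans (+-suc r (suc a)) (cong suc (trans (+-suc r a) (sym (+-comm (r + a) 1)))))
          (chain-triple-π (suc a) (suc (suc a)) (s≤s 1a) ≤-refl (s≤s (s≤s (≤-pred aK)))))
        e1 : suc r + suc K ≡ r + k
        e1 = sym rk
        e2 : suc r + suc K + 1 ≡ N
        e2 = cong suc (trans (+-assoc r (suc K) 1) (cong (r +_) (+-comm (suc K) 1)))
        lastG : G (1 + K) ≡ C
        lastG = trans (cong₂ (λ y z → inπ π (suc r) y z) e1 e2) (Bool-ext fw bw)
          where
          fw : _ → _
          fw h = Newπ.between-rotate sr≤N (leN k ≤-refl) ≤-refl h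
          bw : _ → _
          bw h = Newπ.between-rotate ≤-refl sr≤N (leN k ≤-refl) (Newπ.between-rotate (leN k ≤-refl) ≤-refl sr≤N h)

      -- With X = r+1+j, Y = r+2+j: (r+1,X,Y) and (X,N,Y) give (r+1,N,Y), and
      -- (r+1,Y,r+k) then gives (r+1,N,r+k), against C; for Y = r+k argue alike.
      N-not-between : C ≡ true → ∀ j → 1 ≤ j → j ≤ K → inπ π (r + suc j) N (r + suc (suc j)) ≡ true → ⊥
      N-not-between c j 1j jK T with m≤n⇒m<n∨m≡n jK
      ... | inj₁ jK' = Newπ.between-asym sr≤N ≤-refl (leN k ≤-refl) s3 Cr
        where
        X = r + suc j
        Y = r + suc (suc j)
        Xb : X ≤ N
        Xb = leN (suc j) (≤-trans (n≤1+n _) (s≤s (s≤s (<⇒≤ jK'))))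
        Yb : Y < N
        Yb = ltN (suc (suc j)) (s≤s (s≤s (<⇒≤ jK')))
        h1 = chain-triple-π (suc j) (suc (suc j)) (s≤s 1j) ≤-refl (s≤s (s≤s (<⇒≤ jK')))
        h2 = chain-triple-π (suc (suc j)) k (s≤s (s≤s z≤n)) (s≤s (s≤s jK')) ≤-refl
        h1r = Newπ.between-rotate Xb (<⇒≤ Yb) sr≤N (Newπ.between-rotate sr≤N Xb (<⇒≤ Yb) h1)
        T2 = Newπ.between-rotate ≤-refl (<⇒≤ Yb) Xb (Newπ.between-rotate Xb ≤-refl (<⇒≤ Yb) T)
        s1 = Newπ.between-trans₁ (<⇒≤ Yb) sr≤N Xb ≤-refl h1r T2 (ne Yb) (ne (<-trans sr<rk (ltN k ≤-refl)))
        s2 = Newπ.between-rotate (<⇒≤ Yb) sr≤N ≤-refl s1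
        s3 = Newπ.between-trans₁ sr≤N ≤-refl (<⇒≤ Yb) (leN k ≤-refl) s2 h2 (ne sr<rk) (ne' (ltN k ≤-refl))
        Cr = Newπ.between-rotate ≤-refl sr≤N (leN k ≤-refl) (Newπ.between-rotate (leN k ≤-refl) ≤-refl sr≤N c)
      ... | inj₂ refl = Newπ.between-asym (leN k ≤-refl) Xb sr≤N s1 hr
        where
        X = r + suc K
        Xb : X ≤ N
        Xb = leN (suc K) (n≤1+n _)
        T' : inπ π (r + k) X N ≡ true
        T' = Newπ.between-rotate ≤-refl (leN k ≤-refl) Xb (Newπ.between-rotate Xb ≤-refl (leN k ≤-refl) T)
        s1 = Newπ.between-trans₁ (leN k ≤-refl) Xb ≤-refl sr≤N T' c (ne' sr<rk) (ne' (subst (λ z → z < X) r1 (+-monoʳ-< r (s≤s 1j))))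
        h = chain-triple-π (suc K) k (s≤s 1j) ≤-refl ≤-refl
        hr = Newπ.between-rotate Xb (leN k ≤-refl) sr≤N (Newπ.between-rotate sr≤N Xb (leN k ≤-refl) h)

      middle-unchanged : C ≡ true → middle-L-ok π ≡ middle-L-ok v
      middle-unchanged c = allB-interval-cong 1 K (λ j 1j jK → cong (_≡ᵇ at iv (j ∸ 1)) (Leq j 1j (≤-pred (subst (j <_) refl jK))))
        where
        Leq : ∀ j → 1 ≤ j → j ≤ K → Lπ π (suc (r + j)) (suc (suc (r + j))) ≡ Lπ v (suc (r + j)) (suc (suc (r + j)))
        Leq j 1j jK = trans (L-insertTop xN yN) (trans (cong (Lπ v (suc (r + j)) (suc (suc (r + j))) +_) (ind-false fls)) (+-identityʳ _))
          where
          ex : r + suc j ≡ suc (r + j)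
          ex = +-suc r j
          ey : r + suc (suc j) ≡ suc (suc (r + j))
          ey = trans (+-suc r (suc j)) (cong suc (+-suc r j))
          xN : suc (r + j) < N
          xN = subst (_< N) ex (ltN (suc j) (≤-trans (n≤1+n _) (s≤s (s≤s jK))))
          yN : suc (suc (r + j)) < N
          yN = subst (_< N) ey (ltN (suc (suc j)) (s≤s (s≤s jK)))
          fls : inπ π (suc (r + j)) N (suc (suc (r + j))) ≡ false
          fls with inπ π (suc (r + j)) N (suc (suc (r + j))) in q
          ... | false = refl
          ... | true = ⊥-elim (N-not-between c j 1j jK (subst₂ (λ x y → inπ π x N y ≡ true) (sym ex) (sym ey) q))

      ss≡ : r + 2 ≡ suc (suc r)
      ss≡ = +-comm r 2

      last-two-L : C ≡ true → Lπ π N (suc (suc r)) + β ≡ lastTwoSum K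
      last-two-L c = go K refl
        where
        go : ∀ K' → K' ≡ K → Lπ π N (suc (suc r)) + β ≡ lastTwoSum K'
        go zero refl = trans (+-comm _ β) (subst (λ z → β + Lπ π N z ≡ suc N) ss≡
                              (Newπ.L-complement (leN k ≤-refl) ≤-refl (ne (ltN k ≤-refl))))
        go (suc K') refl = +-cancelˡ-≡ β _ _ (begin
            β + (Lπ π N ssr + β) ≡⟨ cong (β +_) (+-comm _ β) ⟩
            β + (β + Lπ π N ssr) ≡⟨ cong (β +_) (sym (Newπ.L-split (leN k ≤-refl) ≤-refl ssN s)) ⟩
            β + Lπ π (r + k) ssr ≡⟨ cong (β +_) (L-insertTop (ltN k ≤-refl) (<-trans ssr<rk (ltN k ≤-refl))) ⟩
            β + (Lπ v (r + k) ssr + ind (inπ π (r + k) N ssr)) ≡⟨ cong (λ z → β + (Lπ v (r + k) ssr + z)) (ind-true s) ⟩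
            β + (Lπ v (r + k) ssr + 1) ≡⟨ cong (λ z → β + (z + 1)) (B.L-split ≤-refl (<⇒≤ sr<rk) (<⇒≤ ssr<rk) F1v) ⟩
            β + (e' + t0 + 1) ∎)
          where
          open ≡-Reasoning
          ssr = suc (suc r)
          ssr<rk : ssr < r + k
          ssr<rk = subst (_< r + k) ss≡ (+-monoʳ-< r (s≤s (s≤s (s≤s z≤n))))
          ssN : ssr ≤ N
          ssN = <⇒≤ (<-trans ssr<rk (ltN k ≤-refl))
          h2 : inπ π (suc r) ssr (r + k) ≡ true
          h2 = subst (λ z → inπ π (suc r) z (r + k) ≡ true) ss≡ (chain-triple-π 2 k ≤-refl (s≤s (s≤s (s≤s z≤n))) ≤-refl)
          F1 : inπ π (r + k) (suc r) ssr ≡ true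
          F1 = Newπ.between-rotate ssN (leN k ≤-refl) sr≤N (Newπ.between-rotate sr≤N ssN (leN k ≤-refl) h2)
          s : inπ π (r + k) N ssr ≡ true
          s = Newπ.between-trans₁ (leN k ≤-refl) ≤-refl sr≤N ssN c F1 (ne' ssr<rk) (ne' (<-trans ssr<rk (ltN k ≤-refl)))
          h2v : inπ v (suc r) ssr (r + k) ≡ true
          h2v = subst₂ (λ y z → inπ v y z (r + k) ≡ true) r1 ss≡ (Ch.chain-triple-second 2 k ≤-refl (s≤s (s≤s (s≤s z≤n))) ≤-refl)
          F1v : inπ v (r + k) (suc r) ssr ≡ true
          F1v = B.between-rotate (<⇒≤ ssr<rk) ≤-refl (<⇒≤ sr<rk) (B.between-rotate (<⇒≤ sr<rk) (<⇒≤ ssr<rk) ≤-refl h2v)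

    rkN : r + k < N
    rkN = ltN k ≤-refl
    srN : suc r < N
    srN = <-trans sr<rk rkN

    L-insertTop-C : Lπ π (r + k) (suc r) ≡ e' + ind C
    L-insertTop-C = L-insertTop rkN srN

    C≡β< : C ≡ (β <ᵇ suc e')
    C≡β< = Bool-ext fw bw
      where
      fw : C ≡ true → (β <ᵇ suc e') ≡ true
      fw c = <ᵇ-complete (s≤s (+-cancelʳ-≤ 1 β e' (≤-trans (+-monoʳ-≤ β (s≤s z≤n))
               (≤-reflexive (trans (sym (Newπ.L-split (leN k ≤-refl) ≤-refl sr≤N c)) (trans L-insertTop-C (cong (e' +_) (ind-true c))))))))
      bw : (β <ᵇ suc e') ≡ true → C ≡ true
      bw h with C in cq
      ... | true = refl
      ... | false with Newπ.between-total (leN k ≤-refl) sr≤N ≤-refl (ne' sr<rk) (ne srN) (ne rkN)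
      ... | inj₂ t = ⊥-elim (true≢false (trans (sym t) cq))
      ... | inj₁ t = ⊥-elim (<-irrefl refl (<-≤-trans (<ᵇ-sound h) le))
        where
        le : suc e' ≤ β
        le = ≤-trans (≤-reflexive (+-comm 1 e')) (≤-trans (+-monoʳ-≤ e' (s≤s z≤n)) (≤-trans (≤-reflexive (cong (_+ Lπ π (suc r) N) (trans (sym (+-identityʳ e')) (trans (cong (e' +_) (sym (ind-false cq))) (sym L-insertTop-C))))) (≤-reflexive (sym (Newπ.L-split (leN k ≤-refl) sr≤N ≤-refl t)))))

    β≡slotDist : β ≡ slotDist N (P' (r + k)) (toℕ p)
    β≡slotDist = trans (Newπ.L≡cwDist (r + k) N (leN k ≤-refl) ≤-refl (ne rkN)) (cong₂ (cwDist N) (P-lt (r + k) rkN) P-N)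

    inAcheck-char : inAcheck N iv π ≡ (β ≡ᵇ b) ∧ v-admits-slot
    inAcheck-char = Bool-ext fw bw
      where
      fw : inAcheck N iv π ≡ true → ((β ≡ᵇ b) ∧ v-admits-slot) ≡ true
      fw h = ∧-intro (≡ᵇ-complete βb) (∧-intro av (∧-intro (trans (sym (GivenChains.middle-unchanged av c)) midπ)
                (∧-intro (subst (λ z → (z <ᵇ suc e') ≡ true) βb (trans (sym C≡β<) c))
                     (≡ᵇ-complete (trans (cong₂ _+_ (sym ll) (sym βb)) (GivenChains.last-two-L av c))))))
        where
        h1 = trans (sym inAcheck-unfold) h
        hA = ∧-elimˡ {inAhat k π} h1
        hA' = trans (sym inAhat-split) hA
        av = ∧-elimˡ {chains-v} hA'
        ch = ∧-elimʳ {chains-v} hA'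
        c = trans (sym (GivenChains.newChain≡C av)) ch
        rest = ∧-elimʳ {inAhat k π} h1
        hm = ∧-elimˡ {middle-L-ok π ∧ (β ≡ᵇ b)} rest
        midπ = ∧-elimˡ {middle-L-ok π} hm
        βb = ≡ᵇ-sound {β} {b} (∧-elimʳ {middle-L-ok π} hm)
        ll = ≡ᵇ-sound {Lπ π N (suc (suc r))} {ℓ} (∧-elimʳ {middle-L-ok π ∧ (β ≡ᵇ b)} rest)
      bw : ((β ≡ᵇ b) ∧ v-admits-slot) ≡ true → inAcheck N iv π ≡ true
      bw h = trans inAcheck-unfold (∧-intro hA (∧-intro (∧-intro midπ (≡ᵇ-complete βb)) (≡ᵇ-complete ll)))
        where
        βb = ≡ᵇ-sound {β} {b} (∧-elimˡ {β ≡ᵇ b} h)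
        r1' = ∧-elimʳ {β ≡ᵇ b} h
        av = ∧-elimˡ {chains-v} r1'
        r2 = ∧-elimʳ {chains-v} r1'
        midv = ∧-elimˡ {middle-L-ok v} r2
        r3 = ∧-elimʳ {middle-L-ok v} r2
        le = ∧-elimˡ {b <ᵇ suc e'} r3
        eqT = ≡ᵇ-sound {ℓ + b} {lastTwoSum K} (∧-elimʳ {b <ᵇ suc e'} r3)
        c = trans C≡β< (subst (λ z → (z <ᵇ suc e') ≡ true) (sym βb) le)
        ch = trans (GivenChains.newChain≡C av) c
        hA = trans inAhat-split (∧-intro av ch)
        midπ = trans (GivenChains.middle-unchanged av c) midv
        ll : Lπ π N (suc (suc r)) ≡ ℓ
        ll = +-cancelʳ-≡ b _ _ (trans (cong (Lπ π N (suc (suc r)) +_) (sym βb)) (trans (GivenChains.last-two-L av c) (sym eqT)))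

  i' : ℕ → Vec ℕ (suc (suc K))
  i' t = t ∷ addLast (V.last iv ∸ t ∸ 1) (V.init iv)

  reorg : ∀ a x y g → a ∧ ((x ∧ y) ∧ g) ≡ x ∧ (a ∧ (y ∧ g))
  reorg true true y g = refl
  reorg true false y g = refl
  reorg false true y g = refl
  reorg false false y g = refl

  inAcheck-Ψterm-char : ∀ t → inAcheck m' (i' t) v ≡ (t ≡ᵇ t0) ∧ (chains-v ∧ (middle-L-ok v ∧ (e' ≡ᵇ b + (ℓ ∸ t ∸ 1))))
  inAcheck-Ψterm-char t = trans (cong (chains-v ∧_) (cong₂ _∧_ mid lst)) (reorg chains-v (t ≡ᵇ t0) (middle-L-ok v) (e' ≡ᵇ b + (ℓ ∸ t ∸ 1)))
    where
    F : ℕ → Bool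
    F j = Lπ v (m' + j ∸ k) (m' + 1 + j ∸ k) ≡ᵇ at (i' t) (j ∸ 1)
    f1 : F 1 ≡ (t ≡ᵇ t0)
    f1 = trans (cong₂ (λ x y → Lπ v x y ≡ᵇ t) (trans (m'+j∸k 1) (+-comm r 1)) (trans (m'+1+j∸k 1) (cong suc (+-comm r 1)))) (≡ᵇ-sym t0 t)
    mid : allB (range 1 (k ∸ 1)) F ≡ (t ≡ᵇ t0) ∧ middle-L-ok v
    mid = trans (allB≡ F (range1≡interval K)) (cong₂ _∧_ f1 (trans (allB-shift 1 K F)
      (allB-interval-cong 1 K (λ j 1j jK → mj j 1j (≤-pred jK)))))
      where
      mj : ∀ j → 1 ≤ j → j ≤ K → F (suc j) ≡ (Lπ v (suc (r + j)) (suc (suc (r + j))) ≡ᵇ at iv (j ∸ 1))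
      mj (suc j') _ jK = trans (cong₂ (λ x y → Lπ v x y ≡ᵇ at (i' t) (suc j'))
          (trans (m'+j∸k (suc (suc j'))) (+-suc r (suc j')))
          (trans (m'+1+j∸k (suc (suc j'))) (cong suc (+-suc r (suc j')))))
          (cong (Lπ v (suc (r + suc j')) (suc (suc (r + suc j'))) ≡ᵇ_)
            (trans (at-addLast-lt (V.last iv ∸ t ∸ 1) (V.init iv) j' jK) (at-init iv j' (≤-trans jK (n≤1+n K)))))
    lst : (Lπ v m' (m' + 1 ∸ k) ≡ᵇ at (i' t) (k ∸ 1)) ≡ (e' ≡ᵇ b + (ℓ ∸ t ∸ 1))
    lst = cong₂ (λ x y → Lπ v m' x ≡ᵇ y) m'+1∸k
      (trans (at-addLast-eq _ (V.init iv)) (cong₂ _+_ (at-init iv K ≤-refl) (cong (λ z → z ∸ t ∸ 1) (at-last iv))))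

-- For a fixed v, the number of admissible slots equals the number of
-- admissible t; both are 0 or 1.  The hypotheses are the facts about iv ∈ T
-- that are needed: i_{k-1} ≥ 1, and Σ iv = N + 1 when k = 2.
module PerOrder (K r : ℕ) (iv : Vec ℕ (suc (suc K))) (v : Placement (r + suc (suc K))) (Vv : Valid (r + suc (suc K)) v)
  (1b : 1 ≤ at iv K) (hK0 : K ≡ 0 → at iv K + at iv (suc K) ≡ suc (suc (r + suc (suc K)))) where
  open Step K r iv v Vv

  v-admits-t0 : Bool
  v-admits-t0 = chains-v ∧ (middle-L-ok v ∧ (e' ≡ᵇ b + (ℓ ∸ t0 ∸ 1)))

  t0≥1 : 1 ≤ t0
  t0≥1 = s≤s z≤n

  lastTwoSum≡ : (ℓ + b ≡ᵇ lastTwoSum K) ≡ (ℓ + b ≡ᵇ e' + t0 + 1)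
  lastTwoSum≡ = go K refl
    where
    go : ∀ K' → K' ≡ K → (ℓ + b ≡ᵇ lastTwoSum K') ≡ (ℓ + b ≡ᵇ e' + t0 + 1)
    go (suc K') _ = refl
    go zero e = trans (≡ᵇ-complete lb) (sym (≡ᵇ-complete (trans lb (sym et))))
      where
      lb : ℓ + b ≡ suc N
      lb = trans (+-comm ℓ b) (hK0 (sym e))
      kk : r + k ≡ suc (suc r)
      kk = trans (cong (λ z → r + suc (suc z)) (sym e)) (+-comm r 2)
      et : e' + t0 + 1 ≡ suc N
      et = trans (+-comm (e' + t0) 1) (cong suc (subst (λ z → Lπ v (r + k) (suc r) + Lπ v (suc r) z ≡ N) kk
             (B.L-complement ≤-refl (≤-trans (≤-reflexive (+-comm 1 r)) (+-monoʳ-≤ r (s≤s z≤n)))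
                        (λ q → <-irrefl (sym q) (subst (_< r + k) (+-comm r 1) (+-monoʳ-< r (s≤s (s≤s z≤n))))))))

  admits-slot≡admits-t0 : v-admits-slot ≡ v-admits-t0 ∧ (t0 <ᵇ suc (ℓ ∸ 1))
  admits-slot≡admits-t0 = trans (cong (λ z → chains-v ∧ (middle-L-ok v ∧ ((b <ᵇ suc e') ∧ z))) lastTwoSum≡)
        (trans (cong (λ z → chains-v ∧ (middle-L-ok v ∧ z)) core) (reassoc chains-v (middle-L-ok v) _ _))
    where
    core : ((b <ᵇ suc e') ∧ (ℓ + b ≡ᵇ e' + t0 + 1)) ≡ ((e' ≡ᵇ b + (ℓ ∸ t0 ∸ 1)) ∧ (t0 <ᵇ suc (ℓ ∸ 1)))
    core = Bool-ext fw bw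
      where
      fw : _ → _
      fw h with last-entry→ b e' t0 ℓ t0≥1 (≤-pred (<ᵇ-sound (∧-elimˡ {b <ᵇ suc e'} h))) (≡ᵇ-sound {ℓ + b} {e' + t0 + 1} (∧-elimʳ {b <ᵇ suc e'} h))
      ... | (x , y) = ∧-intro (≡ᵇ-complete x) (<ᵇ-complete y)
      bw : _ → _
      bw h with last-entry← b e' t0 ℓ t0≥1 (≡ᵇ-sound {e'} {b + (ℓ ∸ t0 ∸ 1)} (∧-elimˡ {e' ≡ᵇ b + (ℓ ∸ t0 ∸ 1)} h)) (<ᵇ-sound (∧-elimʳ {e' ≡ᵇ b + (ℓ ∸ t0 ∸ 1)} h))
      ... | (x , y) = ∧-intro (<ᵇ-complete (s≤s x)) (≡ᵇ-complete y)

  slot-rk : ℕ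
  slot-rk = posOf v (r + k)
  slot-rk<N : slot-rk < N
  slot-rk<N = s≤s (posOf≤ v (r + k))

  e'≤ : e' ≤ m'
  e'≤ = ≤-pred (subst (_< suc m') (sym (B.L≡cwDist (r + k) (suc r) ≤-refl srm (λ q → <-irrefl (sym q) srk))) (cwDist< m' (posOf v (r + k)) (posOf v (suc r))))
    where
    srm : suc r ≤ r + k
    srm = ≤-trans (≤-reflexive (+-comm 1 r)) (+-monoʳ-≤ r (s≤s z≤n))
    srk : suc r < r + k
    srk = subst (_< r + k) (+-comm r 1) (+-monoʳ-< r (s≤s (s≤s z≤n)))

  slot-term : ∀ p → ind (0 <ᵇ toℕ p) * ind (inAcheck N iv (insertTop p v)) ≡ (ind (0 <ᵇ toℕ p) * ind (slotDist N slot-rk (toℕ p) ≡ᵇ b)) * ind v-admits-slot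
  slot-term p with 0 <ᵇ toℕ p in q
  ... | false = refl
  ... | true = trans (*-identityˡ _) (trans (cong ind (AtSlot.inAcheck-char p pp))
                 (trans (ind-∧ (AtSlot.β p pp ≡ᵇ b) v-admits-slot)
                   (cong (_* ind v-admits-slot) (trans (cong (λ z → ind (z ≡ᵇ b)) (AtSlot.β≡slotDist p pp)) (sym (*-identityˡ _))))))
    where pp = <ᵇ-sound q

  -- exactly one slot works when v-admits-slot holds (slotDist-hits-once), none otherwise
  slots-count : ∑ (allFin (suc N)) (λ p → ind (0 <ᵇ toℕ p) * ind (inAcheck N iv (insertTop p v))) ≡ ind v-admits-slot
  slots-count = trans (∑-cong (allFin (suc N)) slot-term)
    (trans (∑-allFin-toℕ (suc N) (λ x → (ind (0 <ᵇ x) * ind (slotDist N slot-rk x ≡ᵇ b)) * ind v-admits-slot))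
    (trans (∑-*ʳ (interval 0 (suc N)) (λ x → ind (0 <ᵇ x) * ind (slotDist N slot-rk x ≡ᵇ b)) (ind v-admits-slot)) fin))
    where
    fin : ∑ (interval 0 (suc N)) (λ x → ind (0 <ᵇ x) * ind (slotDist N slot-rk x ≡ᵇ b)) * ind v-admits-slot ≡ ind v-admits-slot
    fin with v-admits-slot in zq
    ... | false = *-zeroʳ (∑ (interval 0 (suc N)) (λ x → ind (0 <ᵇ x) * ind (slotDist N slot-rk x ≡ᵇ b)))
    ... | true = trans (*-identityʳ _) (slotDist-hits-once N slot-rk b slot-rk<N 1b bN)
      where
      bN : b ≤ N
      bN = ≤-trans (≤-pred (<ᵇ-sound (∧-elimˡ {b <ᵇ suc e'} (∧-elimʳ {middle-L-ok v} (∧-elimʳ {chains-v} zq))))) (≤-trans e'≤ (n≤1+n m'))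

  Ψ-term : ∀ t → ind (inAcheck m' (i' t) v) ≡ ind (t ≡ᵇ t0) * ind v-admits-t0
  Ψ-term t = trans (cong ind (inAcheck-Ψterm-char t)) (go (t ≡ᵇ t0) refl)
    where
    go : ∀ c → c ≡ (t ≡ᵇ t0) → ind (c ∧ (chains-v ∧ (middle-L-ok v ∧ (e' ≡ᵇ b + (ℓ ∸ t ∸ 1))))) ≡ ind c * ind v-admits-t0
    go false _ = refl
    go true q = trans (cong (λ z → ind (chains-v ∧ (middle-L-ok v ∧ (e' ≡ᵇ b + (ℓ ∸ z ∸ 1))))) (≡ᵇ-sound {t} {t0} (sym q))) (sym (+-identityʳ _))

  Ψ-terms-count : ∑ (interval 1 (V.last iv ∸ 1)) (λ t → ind (inAcheck m' (i' t) v)) ≡ ind v-admits-t0 * ind (t0 <ᵇ suc (ℓ ∸ 1))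
  Ψ-terms-count = trans (cong (λ z → ∑ (interval 1 (z ∸ 1)) (λ t → ind (inAcheck m' (i' t) v))) (at-last iv))
    (trans (∑-cong (interval 1 (ℓ ∸ 1)) Ψ-term) fin)
    where
    fin : ∑ (interval 1 (ℓ ∸ 1)) (λ t → ind (t ≡ᵇ t0) * ind v-admits-t0) ≡ ind v-admits-t0 * ind (t0 <ᵇ suc (ℓ ∸ 1))
    fin with t0 <ᵇ suc (ℓ ∸ 1) in q
    ... | true = trans (∑-interval-point 1 (ℓ ∸ 1) t0 (λ _ → ind v-admits-t0) t0≥1 (<ᵇ-sound q)) (sym (*-identityʳ (ind v-admits-t0)))
    ... | false = trans (∑-interval-outside 1 (ℓ ∸ 1) t0 (λ _ → ind v-admits-t0) (λ (_ , h) → true≢false (trans (sym (<ᵇ-complete h)) q))) (sym (*-zeroʳ (ind v-admits-t0)))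

  slots≡Ψ-terms : ∑ (allFin (suc N)) (λ p → ind (0 <ᵇ toℕ p) * ind (inAcheck N iv (insertTop p v))) ≡ ∑ (interval 1 (V.last iv ∸ 1)) (λ t → ind (inAcheck m' (i' t) v))
  slots≡Ψ-terms = trans slots-count (trans (cong ind admits-slot≡admits-t0) (trans (ind-∧ v-admits-t0 _) (sym Ψ-terms-count)))

recursion-step : ∀ K r (iv : Vec ℕ (suc (suc K))) → InT (suc (r + suc (suc K)) + 1) iv →
  a (suc (r + suc (suc K))) iv ≡ (Ω ∘ Ψ) (a (r + suc (suc K))) iv
recursion-step K r (x ∷ xs) (allp , hs) = begin
  length (L.filterᵇ (inAcheck N iv) (cyclicOrders N))
    ≡⟨ count-by-insertion m' (inAcheck N iv) ⟩
  ∑ (cyclicOrders m') (λ u → ∑ (allFin (suc N)) (λ p → ind (0 <ᵇ toℕ p) * ind (inAcheck N iv (insertTop p u))))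
    ≡⟨ ∑-filter-cong (isCyclicOrder m') (allVecs (suc m') (suc m')) _ _ (λ u vu → PerOrder.slots≡Ψ-terms K r iv u (isCyclicOrder-sound m' u vu) 1b hK0) ⟩
  ∑ (cyclicOrders m') (λ u → ∑ (interval 1 (ℓ' ∸ 1)) (λ t → ind (inAcheck m' (i' t) u)))
    ≡⟨ sym (∑-swap (interval 1 (ℓ' ∸ 1)) (cyclicOrders m') (λ t u → ind (inAcheck m' (i' t) u))) ⟩
  ∑ (interval 1 (ℓ' ∸ 1)) (λ t → ∑ (cyclicOrders m') (λ u → ind (inAcheck m' (i' t) u)))
    ≡⟨ sym (∑-cong (interval 1 (ℓ' ∸ 1)) (λ t → length-filter (inAcheck m' (i' t)) (cyclicOrders m'))) ⟩
  ∑ (interval 1 (ℓ' ∸ 1)) (λ t → a m' (i' t))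
    ≡⟨ cong (λ z → ∑ z (λ t → a m' (i' t))) (sym (range≡interval 1 (ℓ' ∸ 1))) ⟩
  ∑ (range 1 (ℓ' ∸ 1)) (λ t → a m' (i' t))
    ≡⟨ sym (sumL-map≡∑ (λ t → a m' (i' t)) (range 1 (ℓ' ∸ 1))) ⟩
  (Ω ∘ Ψ) (a m') iv ∎
  where
  open ≡-Reasoning
  iv = x ∷ xs
  k = suc (suc K)
  m' = r + k
  N = suc m'
  ℓ' = V.last iv
  i' : ℕ → Vec ℕ (suc (suc K))
  i' t = t ∷ addLast (ℓ' ∸ t ∸ 1) (V.init iv)
  1b : 1 ≤ at iv K
  1b = All-at K allp (≤-trans (n≤1+n (suc K)) ≤-refl)
  hK0 : K ≡ 0 → at iv K + at iv (suc K) ≡ suc (suc (r + suc (suc K)))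
  hK0 = two-entry-sum K r x xs hs

theorem7p4 : (n k : ℕ) → 3 ≤ n → 2 ≤ k → k ≤ n ∸ 1 →
    (iv : Vec ℕ k) → InT (n + 1) iv →
    a n iv ≡ (Ω ∘ Ψ) (a (n ∸ 1)) iv
theorem7p4 (suc m') (suc (suc K)) _ _ kle iv hT =
  subst (λ z → a (suc z) iv ≡ (Ω ∘ Ψ) (a z) iv) e
    (recursion-step K (m' ∸ suc (suc K)) iv (subst (λ z → InT (suc z + 1) iv) (sym e) hT))
  where
  e : m' ∸ suc (suc K) + suc (suc K) ≡ m'
  e = m∸n+n≡m kle
theorem7p4 (suc m') (suc zero) _ (s≤s ()) _ _ _
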